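{- Let $n\ge 1$, $r\ge 2$, $s\ge 1$ be integers and $k=rs$. Let $G_{r,2s}(2n)$ be the graph with vertex set $\{u_i,v_i: 1\le i\le 2k\}\cup\{y_{b,j},z_{b,j}: 1\le b\le r,\ 1\le j\le 2n\}$ and edges: $u_iv_i$ for $1\le i\le 2k$; and, for each $1\le b\le r$, each $i\in\{(b-1)s+1,\dots,bs\}$ and each $1\le j\le 2n$, the edges $u_iy_{b,j}$, $v_{2k+1-i}y_{b,j}$, $v_iz_{b,j}$, $u_{2k+1-i}z_{b,j}$. Then $\chi_{la}(G_{r,2s}(2n))=3$.
   Context: For a graph $G$ with $q$ edges, a local antimagic labeling is a bijection $f:E(G)\to\{1,\dots,q\}$ such that, writing $f^+(u)=\sum_{e\ni u}f(e)$, we have $f^+(u)\ne f^+(v)$ for every edge $uv$. $\chi_{la}(G)$ is the minimum over all local antimagic labelings of the number of distinct values of $f^+$. -}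

module Defs where

open import Data.Nat using (ℕ; zero; suc; _+_; _*_; _∸_; _≤_)
open import Data.Nat.Properties using (suc-injective) renaming (_≟_ to _≟ℕ_)
open import Data.Fin using (Fin; toℕ)
open import Data.List using (List; []; _∷_; _++_; map; concatMap; applyUpTo; length; lookup; allFin; deduplicate)
open import Data.Nat.ListAction using (sum)
open import Data.Product using (_×_; _,_; proj₁; proj₂; Σ)
open import Data.Bool using (if_then_else_)
open import Relation.Nullary using (Dec; yes; no; ¬_; does)
open import Relation.Binary.PropositionalEquality using (_≡_; refl; cong; cong₂)
open import Function.Definitions using (Bijective)

-- Vertices of G_{r,2s}(2n), 1-based indices as in the paper:
-- u i, v i  (1 ≤ i ≤ 2k);   y b j, z b j  (1 ≤ b ≤ r, 1 ≤ j ≤ 2n).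
data V : Set where
  u v : ℕ → V
  y z : ℕ → ℕ → V

u-inj : ∀ {i j} → u i ≡ u j → i ≡ j
u-inj refl = refl
v-inj : ∀ {i j} → v i ≡ v j → i ≡ j
v-inj refl = refl
y-inj : ∀ {a b c d} → y a b ≡ y c d → (a ≡ c) × (b ≡ d)
y-inj refl = refl , refl
z-inj : ∀ {a b c d} → z a b ≡ z c d → (a ≡ c) × (b ≡ d)
z-inj refl = refl , refl

_≟V_ : (p q : V) → Dec (p ≡ q)
u i ≟V u j with i ≟ℕ j
... | yes refl = yes refl
... | no ne = no λ e → ne (u-inj e)
u i ≟V v j = no λ ()
u i ≟V y a b = no λ ()
u i ≟V z a b = no λ ()
v i ≟V u j = no λ ()
v i ≟V v j with i ≟ℕ j
... | yes refl = yes refl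
... | no ne = no λ e → ne (v-inj e)
v i ≟V y a b = no λ ()
v i ≟V z a b = no λ ()
y a b ≟V u j = no λ ()
y a b ≟V v j = no λ ()
y a b ≟V y c d with a ≟ℕ c | b ≟ℕ d
... | yes refl | yes refl = yes refl
... | no ne | _ = no λ e → ne (proj₁ (y-inj e))
... | yes _ | no ne = no λ e → ne (proj₂ (y-inj e))
y a b ≟V z c d = no λ ()
z a b ≟V u j = no λ ()
z a b ≟V v j = no λ ()
z a b ≟V y c d = no λ ()
z a b ≟V z c d with a ≟ℕ c | b ≟ℕ d
... | yes refl | yes refl = yes refl
... | no ne | _ = no λ e → ne (proj₁ (z-inj e))
... | yes _ | no ne = no λ e → ne (proj₂ (z-inj e))

fromTo : ℕ → ℕ → List ℕ
fromTo a b = applyUpTo (a +_) (suc b ∸ a)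

vertices : (n r s : ℕ) → List V
vertices n r s =
  map u (fromTo 1 (2 * (r * s))) ++ map v (fromTo 1 (2 * (r * s))) ++
  concatMap (λ b → map (y b) (fromTo 1 (2 * n)) ++ map (z b) (fromTo 1 (2 * n))) (fromTo 1 r)

edges : (n r s : ℕ) → List (V × V)
edges n r s =
  map (λ i → u i , v i) (fromTo 1 (2 * k)) ++
  concatMap (λ b →
    concatMap (λ i →
      concatMap (λ j →
        (u i , y b j) ∷ (v (suc (2 * k) ∸ i) , y b j) ∷
        (v i , z b j) ∷ (u (suc (2 * k) ∸ i) , z b j) ∷ [])
      (fromTo 1 (2 * n)))
    (fromTo (suc ((b ∸ 1) * s)) (b * s)))
  (fromTo 1 r)
  where k = r * s

module _ (E : List (V × V)) where

  q : ℕ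
  q = length E

  -- an edge labeling: a bijection E(G) → {1,…,q}, encoded as a bijection
  -- Fin q → Fin q, with label of edge e being 1 + toℕ (f e)
  Labeling : Set
  Labeling = Σ (Fin q → Fin q) (Bijective _≡_ _≡_)

  label : Labeling → Fin q → ℕ
  label f e = suc (toℕ (proj₁ f e))


  fplus : Labeling → V → ℕ
  fplus f w = sum (map (λ e → if (does (w ≟V proj₁ (lookup E e))) then label f e
                              else (if does (w ≟V proj₂ (lookup E e)) then label f e else 0))
                  (allFin q))

  LocalAntimagic : Labeling → Set
  LocalAntimagic f = (e : Fin q) → ¬ (fplus f (proj₁ (lookup E e)) ≡ fplus f (proj₂ (lookup E e)))

  numColors : List V → Labeling → ℕ
  numColors Vs f = length (deduplicate _≟ℕ_ (map (fplus f) Vs))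

  ChiLaEq : List V → ℕ → Set
  ChiLaEq Vs c = Σ Labeling (λ f → LocalAntimagic f × numColors Vs f ≡ c)
               × ((f : Labeling) → LocalAntimagic f → c ≤ numColors Vs f)

module Submission where

-- The perfect matching {u_i v_i} takes the labels 1, …, 2k; the remaining labels are arranged in
-- complementary pairs ℓ, C − ℓ (C = q + 2k + 1) meeting at every y_{b,j} and z_{b,j}, so all of
-- these vertices receive s·C, and the rows at u_i and v_i are chosen so that all u's receive one
-- value and all v's another, neither a multiple of C.  This gives three colours.  Two colours are
-- impossible: the component of block 1 would be properly 2-coloured with colour classes A, B of
-- the same size N, every edge has equally many ends in A and in B, and double counting the labels
-- gives N·α = N·β.

open import Defs
open import Data.Nat using (ℕ; zero; suc; _+_; _*_; _∸_; _≤_; _<_; z≤n; s≤s; s≤s⁻¹; NonZero; >-nonZero; _/_; _%_)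
open import Data.Nat.Properties
open import Algebra.Properties.CommutativeSemigroup +-commutativeSemigroup using () renaming (interchange to +-interchange)
open import Data.Nat.DivMod using (m≡m%n+[m/n]*n; m%n<n; m<n*o⇒m/o<n)
open import Data.Nat.ListAction using (sum)
open import Data.Nat.ListAction.Properties using (sum-++)
open import Data.Nat.Tactic.RingSolver using (solve-∀)
open import Data.Bool using (Bool; true; false; if_then_else_)
open import Data.Fin using (Fin; toℕ; fromℕ<; punchOut)
open import Data.Fin.Properties using (punchOut-injective; injective⇒≤; any?; toℕ-fromℕ<; toℕ<n; toℕ-injective) renaming (_≟_ to _≟ᶠ_)
open import Data.List using (List; []; _∷_; _++_; map; concatMap; applyUpTo; length; lookup; allFin; deduplicate)
open import Data.List.Properties using (map-++; map-∘; map-cong; map-cong-local; map-tabulate; tabulate-lookup; length-++)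
open import Data.List.Relation.Unary.All as All using (All; []; _∷_)
import Data.List.Relation.Unary.All.Properties as All
open import Data.List.Relation.Unary.All.Properties using (¬All⇒Any¬)
open import Data.List.Relation.Unary.Any as Any using (here; there)
open import Data.List.Relation.Unary.Any.Properties using (lookup-index)
open import Data.List.Relation.Unary.AllPairs using ([]; _∷_)
open import Data.List.Relation.Unary.Unique.Propositional using (Unique)
open import Data.List.Relation.Unary.Unique.DecPropositional.Properties _≟_ using (deduplicate-!)
open import Data.List.Membership.Propositional using (_∈_; find)
open import Data.List.Membership.Propositional.Properties using (∈-++⁺ˡ; ∈-++⁺ʳ; ∈-++⁻; ∈-∃++; ∈-map⁺; ∈-lookup; ∈-deduplicate⁺; ∈-deduplicate⁻)
open import Data.Product using (_×_; _,_; proj₁; proj₂; Σ)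
open import Data.Sum using (_⊎_; inj₁; inj₂)
open import Data.Empty using (⊥; ⊥-elim)
open import Relation.Nullary using (¬_; yes; no; does)
open import Relation.Nullary.Decidable using (dec-true; dec-false; _⊎-dec_)
open import Relation.Binary.PropositionalEquality
open import Function using (_∘_)
open import Function.Definitions using (Injective; Bijective; StrictlySurjective)
open import Function.Consequences.Propositional using (strictlySurjective⇒surjective)

∑ : {A : Set} → List A → (A → ℕ) → ℕ
∑ xs g = sum (map g xs)

∑-cong : ∀ {A : Set} (xs : List A) {g h : A → ℕ} → (∀ x → g x ≡ h x) → ∑ xs g ≡ ∑ xs h
∑-cong xs eq = cong sum (map-cong eq xs)

∑-≡0 : ∀ {A : Set} (xs : List A) {g : A → ℕ} → (∀ x → g x ≡ 0) → ∑ xs g ≡ 0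
∑-≡0 [] h = refl
∑-≡0 (x ∷ xs) h = cong₂ _+_ (h x) (∑-≡0 xs h)

∑-+ : ∀ {A : Set} (xs : List A) (g h : A → ℕ) → ∑ xs (λ x → g x + h x) ≡ ∑ xs g + ∑ xs h
∑-+ [] g h = refl
∑-+ (x ∷ xs) g h = trans (cong (g x + h x +_) (∑-+ xs g h)) (+-interchange (g x) (h x) (∑ xs g) (∑ xs h))

∑-*ʳ : ∀ {A : Set} (xs : List A) (g : A → ℕ) c → ∑ xs (λ x → g x * c) ≡ ∑ xs g * c
∑-*ʳ [] g c = refl
∑-*ʳ (x ∷ xs) g c = trans (cong (g x * c +_) (∑-*ʳ xs g c)) (sym (*-distribʳ-+ c (g x) (∑ xs g)))

∑-swap : ∀ {A B : Set} (xs : List A) (ys : List B) (g : A → B → ℕ) →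
  ∑ xs (λ x → ∑ ys (g x)) ≡ ∑ ys (λ x′ → ∑ xs (λ x → g x x′))
∑-swap [] ys g = sym (∑-≡0 ys (λ _ → refl))
∑-swap (x ∷ xs) ys g = trans (cong (∑ ys (g x) +_) (∑-swap xs ys g)) (sym (∑-+ ys (g x) _))

∑-++ : ∀ {A : Set} (xs ys : List A) (g : A → ℕ) → ∑ (xs ++ ys) g ≡ ∑ xs g + ∑ ys g
∑-++ xs ys g = trans (cong sum (map-++ g xs ys)) (sum-++ (map g xs) (map g ys))

∑-map : ∀ {A B : Set} (f : A → B) (xs : List A) (g : B → ℕ) → ∑ (map f xs) g ≡ ∑ xs (g ∘ f)
∑-map f xs g = cong sum (sym (map-∘ xs))

∑-concatMap : ∀ {A B : Set} (f : A → List B) (xs : List A) (g : B → ℕ) →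
  ∑ (concatMap f xs) g ≡ ∑ xs (λ x → ∑ (f x) g)
∑-concatMap f [] g = refl
∑-concatMap f (x ∷ xs) g = trans (∑-++ (f x) (concatMap f xs) g) (cong (∑ (f x) g +_) (∑-concatMap f xs g))

All-concatMap : ∀ {A B : Set} {P : B → Set} (f : A → List B) (xs : List A) →
  All (λ x → All P (f x)) xs → All P (concatMap f xs)
All-concatMap f [] [] = []
All-concatMap f (x ∷ xs) (px ∷ pxs) = All.++⁺ px (All-concatMap f xs pxs)

∈-concatMap : ∀ {A B : Set} (f : A → List B) {t : B} {x : A} (xs : List A) → t ∈ f x → x ∈ xs → t ∈ concatMap f xs
∈-concatMap f (x ∷ xs) t∈ (here refl) = ∈-++⁺ˡ t∈
∈-concatMap f (x ∷ xs) t∈ (there x∈) = ∈-++⁺ʳ (f x) (∈-concatMap f xs t∈ x∈)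

∑-cong-All : ∀ {A : Set} {xs : List A} {g h : A → ℕ} → All (λ x → g x ≡ h x) xs → ∑ xs g ≡ ∑ xs h
∑-cong-All eqs = cong sum (map-cong-local eqs)

∑-≡0-All : ∀ {A : Set} {xs : List A} {g : A → ℕ} → All (λ x → g x ≡ 0) xs → ∑ xs g ≡ 0
∑-≡0-All {xs = xs} eqs = trans (∑-cong-All eqs) (∑-≡0 xs (λ _ → refl))

range : ℕ → ℕ → List ℕ
range a zero = []
range a (suc m) = a ∷ range (suc a) m

applyUpTo≡range : ∀ (f : ℕ → ℕ) a m → (∀ x → f x ≡ a + x) → applyUpTo f m ≡ range a m
applyUpTo≡range f a zero f≗ = refl
applyUpTo≡range f a (suc m) f≗ = cong₂ _∷_ (trans (f≗ 0) (+-identityʳ a))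
  (applyUpTo≡range (f ∘ suc) (suc a) m (λ x → trans (f≗ (suc x)) (+-suc a x)))

fromTo≡range : ∀ a b → fromTo a b ≡ range a (suc b ∸ a)
fromTo≡range a b = applyUpTo≡range (a +_) a (suc b ∸ a) (λ _ → refl)

private
  range-tail : ∀ {a m x} → suc a ≤ x → x < suc a + m → (a ≤ x) × (x < a + suc m)
  range-tail {a} {m} {x} p q = <⇒≤ p , subst (x <_) (sym (+-suc a m)) q

  range-head : ∀ a m → a < a + suc m
  range-head a m = m<m+n a (s≤s z≤n)

  range-empty : ∀ {a x} → a ≤ x → ¬ x < a + 0
  range-empty {a} p q = <-irrefl refl (<-≤-trans q (≤-trans (≤-reflexive (+-identityʳ a)) p))

All-range : ∀ {P : ℕ → Set} a m → (∀ x → a ≤ x → x < a + m → P x) → All P (range a m)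
All-range a zero h = []
All-range a (suc m) h = h a ≤-refl (range-head a m) ∷
  All-range (suc a) m (λ x p q → let p′ , q′ = range-tail p q in h x p′ q′)

∈-range : ∀ a m x → a ≤ x → x < a + m → x ∈ range a m
∈-range a zero x p q = ⊥-elim (range-empty p q)
∈-range a (suc m) x p q with a ≟ x
... | yes refl = here refl
... | no a≢x = there (∈-range (suc a) m x (≤∧≢⇒< p a≢x) (subst (x <_) (+-suc a m) q))

range-∑-single : ∀ a m x₀ {g : ℕ → ℕ} → a ≤ x₀ → x₀ < a + m →
  (∀ x → a ≤ x → x < a + m → x ≢ x₀ → g x ≡ 0) → ∑ (range a m) g ≡ g x₀
range-∑-single a zero x₀ p q g0 = ⊥-elim (range-empty p q)
range-∑-single a (suc m) x₀ {g} p q g0 with a ≟ x₀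
... | yes refl = trans (cong (g a +_) (∑-≡0-All (All-range (suc a) m
        (λ x p′ q′ → let p″ , q″ = range-tail p′ q′ in g0 x p″ q″ (λ x≡a → <-irrefl (sym x≡a) p′)))))
      (+-identityʳ (g a))
... | no a≢x₀ = trans (cong (_+ ∑ (range (suc a) m) g) (g0 a ≤-refl (range-head a m) a≢x₀))
      (range-∑-single (suc a) m x₀ (≤∧≢⇒< p a≢x₀) (subst (x₀ <_) (+-suc a m) q)
        (λ x p′ q′ → let p″ , q″ = range-tail p′ q′ in g0 x p″ q″))

range-∑-const : ∀ a m c → ∑ (range a m) (λ _ → c) ≡ m * c
range-∑-const a zero c = refl
range-∑-const a (suc m) c = cong (c +_) (range-∑-const (suc a) m c)

range-++ : ∀ a m₁ m₂ → range a (m₁ + m₂) ≡ range a m₁ ++ range (a + m₁) m₂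
range-++ a zero m₂ = cong (λ b → range b m₂) (sym (+-identityʳ a))
range-++ a (suc m₁) m₂ = cong (a ∷_) (trans (range-++ (suc a) m₁ m₂) (cong (λ b → range (suc a) m₁ ++ range b m₂) (sym (+-suc a m₁))))

private
  ≤⇒<-end : ∀ {a c i} → a ≤ i → i ≤ c → i < a + (suc c ∸ a)
  ≤⇒<-end {a} {c} {i} p q = subst (i <_) (sym (m+[n∸m]≡n (≤-trans p (m≤n⇒m≤1+n q)))) (s≤s q)

  <-end⇒≤ : ∀ {a c i} → a ≤ i → i < a + (suc c ∸ a) → i ≤ c
  <-end⇒≤ {a} {c} {i} p q with a ≤? suc c
  ... | yes a≤ = s≤s⁻¹ (subst (i <_) (m+[n∸m]≡n a≤) q)
  ... | no a≰ = ⊥-elim (range-empty p (subst (λ d → i < a + d) (m≤n⇒m∸n≡0 (≰⇒≥ a≰)) q))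

All-fromTo : ∀ {P : ℕ → Set} a c → (∀ i → a ≤ i → i ≤ c → P i) → All P (fromTo a c)
All-fromTo {P} a c h = subst (All P) (sym (fromTo≡range a c))
  (All-range a (suc c ∸ a) (λ i p q → h i p (<-end⇒≤ p q)))

∈-fromTo : ∀ a c i → a ≤ i → i ≤ c → i ∈ fromTo a c
∈-fromTo a c i p q = subst (i ∈_) (sym (fromTo≡range a c)) (∈-range a (suc c ∸ a) i p (≤⇒<-end p q))

fromTo-∑-cong : ∀ a c {g h : ℕ → ℕ} → (∀ i → a ≤ i → i ≤ c → g i ≡ h i) → ∑ (fromTo a c) g ≡ ∑ (fromTo a c) h
fromTo-∑-cong a c eq = ∑-cong-All (All-fromTo a c eq)

fromTo-∑-≡0 : ∀ a c {g : ℕ → ℕ} → (∀ i → a ≤ i → i ≤ c → g i ≡ 0) → ∑ (fromTo a c) g ≡ 0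
fromTo-∑-≡0 a c eq = ∑-≡0-All (All-fromTo a c eq)

fromTo-∑-single : ∀ a c i₀ {g : ℕ → ℕ} → a ≤ i₀ → i₀ ≤ c →
  (∀ i → a ≤ i → i ≤ c → i ≢ i₀ → g i ≡ 0) → ∑ (fromTo a c) g ≡ g i₀
fromTo-∑-single a c i₀ {g} p q g0 = trans (cong (λ xs → ∑ xs g) (fromTo≡range a c))
  (range-∑-single a (suc c ∸ a) i₀ p (≤⇒<-end p q) (λ i p′ q′ → g0 i p′ (<-end⇒≤ p′ q′)))

range-shift : ∀ c a m → range (c + a) m ≡ map (c +_) (range a m)
range-shift c a zero = refl
range-shift c a (suc m) = cong (c + a ∷_) (trans (cong (λ b → range b m) (sym (+-suc c a))) (range-shift c (suc a) m))

∑-range-shift : ∀ c a m g → ∑ (range (c + a) m) g ≡ ∑ (range a m) (λ x → g (c + x))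
∑-range-shift c a m g = trans (cong (λ xs → ∑ xs g) (range-shift c a m)) (∑-map (c +_) (range a m) g)

fromTo-∑-const : ∀ c x → ∑ (fromTo 1 c) (λ _ → x) ≡ c * x
fromTo-∑-const c x = trans (cong (λ xs → ∑ xs (λ _ → x)) (fromTo≡range 1 c)) (range-∑-const 1 c x)

injective⇒strictlySurjective : ∀ {n} {g : Fin n → Fin n} → Injective _≡_ _≡_ g → StrictlySurjective _≡_ g
injective⇒strictlySurjective {zero} g-inj ()
injective⇒strictlySurjective {suc n} {g} g-inj t with any? (λ x → g x ≟ᶠ t)
... | yes hit = hit
... | no miss = ⊥-elim (1+n≰n (injective⇒≤ {f = avoid} avoid-inj))
  where
  t≢g : ∀ x → t ≢ g x
  t≢g x t≡gx = miss (x , sym t≡gx)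

  avoid : Fin (suc n) → Fin n
  avoid x = punchOut (t≢g x)

  avoid-inj : Injective _≡_ _≡_ avoid
  avoid-inj {a} {b} e = g-inj (punchOut-injective (t≢g a) (t≢g b) e)

strictlySurjective⇒bijective : ∀ {n} {f : Fin n → Fin n} → StrictlySurjective _≡_ f → Bijective _≡_ _≡_ f
strictlySurjective⇒bijective {n} {f} surj = f-inj , strictlySurjective⇒surjective surj
  where
  section : Fin n → Fin n
  section t = proj₁ (surj t)

  f∘section : ∀ t → f (section t) ≡ t
  f∘section t = proj₂ (surj t)

  section-inj : Injective _≡_ _≡_ section
  section-inj {a} {b} e = trans (sym (f∘section a)) (trans (cong f e) (f∘section b))

  f-inj : Injective _≡_ _≡_ f
  f-inj {a} {b} e with injective⇒strictlySurjective section-inj a | injective⇒strictlySurjective section-inj b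
  ... | a′ , refl | b′ , refl = cong section (trans (sym (f∘section a′)) (trans e (f∘section b′)))

∈⇒delete : ∀ {x : ℕ} {xs} → x ∈ xs →
  Σ (List ℕ) λ ys → (length xs ≡ suc (length ys)) × (∀ {z} → z ∈ xs → z ≢ x → z ∈ ys)
∈⇒delete {x} x∈ with ∈-∃++ x∈
... | ys , zs , refl = ys ++ zs , length-eq , keep
  where
  length-eq : length (ys ++ x ∷ zs) ≡ suc (length (ys ++ zs))
  length-eq = trans (length-++ ys) (trans (+-suc (length ys) (length zs)) (cong suc (sym (length-++ ys))))

  keep : ∀ {z} → z ∈ ys ++ x ∷ zs → z ≢ x → z ∈ ys ++ zs
  keep z∈ z≢x with ∈-++⁻ ys z∈
  ... | inj₁ p = ∈-++⁺ˡ p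
  ... | inj₂ (here refl) = ⊥-elim (z≢x refl)
  ... | inj₂ (there p) = ∈-++⁺ʳ ys p

unique-⊆⇒length≤ : ∀ {xs : List ℕ} ys → Unique xs → (∀ {z} → z ∈ xs → z ∈ ys) → length xs ≤ length ys
unique-⊆⇒length≤ {[]} ys _ _ = z≤n
unique-⊆⇒length≤ {x ∷ xs} ys (x∉xs ∷ xs!) xs⊆ys with ∈⇒delete (xs⊆ys (here refl))
... | ys′ , length-eq , keep = subst (suc (length xs) ≤_) (sym length-eq)
  (s≤s (unique-⊆⇒length≤ ys′ xs! (λ z∈ → keep (xs⊆ys (there z∈)) (λ z≡x → All.lookup x∉xs z∈ (sym z≡x)))))

length-deduplicate≥3 : ∀ (xs : List ℕ) {a b c : ℕ} → a ∈ xs → b ∈ xs → c ∈ xs →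
  a ≢ b → a ≢ c → b ≢ c → 3 ≤ length (deduplicate _≟_ xs)
length-deduplicate≥3 xs a∈ b∈ c∈ a≢b a≢c b≢c =
  unique-⊆⇒length≤ (deduplicate _≟_ xs) ((a≢b ∷ a≢c ∷ []) ∷ (b≢c ∷ []) ∷ [] ∷ []) ⊆dedup
  where
  ⊆dedup : ∀ {z} → z ∈ _ ∷ _ ∷ _ ∷ [] → z ∈ deduplicate _≟_ xs
  ⊆dedup (here refl) = ∈-deduplicate⁺ _≟_ a∈
  ⊆dedup (there (here refl)) = ∈-deduplicate⁺ _≟_ b∈
  ⊆dedup (there (there (here refl))) = ∈-deduplicate⁺ _≟_ c∈

length-deduplicate≤3 : ∀ (xs : List ℕ) (a b c : ℕ) → All (λ x → x ≡ a ⊎ x ≡ b ⊎ x ≡ c) xs →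
  length (deduplicate _≟_ xs) ≤ 3
length-deduplicate≤3 xs a b c xs⊆abc =
  unique-⊆⇒length≤ (a ∷ b ∷ c ∷ []) (deduplicate-! xs) (λ z∈ → toList (All.lookup xs⊆abc (∈-deduplicate⁻ _≟_ xs z∈)))
  where
  toList : ∀ {z} → z ≡ a ⊎ z ≡ b ⊎ z ≡ c → z ∈ a ∷ b ∷ c ∷ []
  toList (inj₁ refl) = here refl
  toList (inj₂ (inj₁ refl)) = there (here refl)
  toList (inj₂ (inj₂ refl)) = there (there (here refl))

incidence : V → V × V → ℕ → ℕ
incidence w e ℓ = if does (w ≟V proj₁ e) then ℓ else (if does (w ≟V proj₂ e) then ℓ else 0)

incidence-fst : ∀ {ℓ} w a b → w ≡ a → incidence w (a , b) ℓ ≡ ℓ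
incidence-fst w _ _ refl rewrite dec-true (w ≟V w) refl = refl

incidence-snd : ∀ {ℓ} w a b → w ≢ a → w ≡ b → incidence w (a , b) ℓ ≡ ℓ
incidence-snd w a _ w≢a refl rewrite dec-false (w ≟V a) w≢a | dec-true (w ≟V w) refl = refl

incidence-none : ∀ {ℓ} w a b → w ≢ a → w ≢ b → incidence w (a , b) ℓ ≡ 0
incidence-none w a b w≢a w≢b rewrite dec-false (w ≟V a) w≢a | dec-false (w ≟V b) w≢b = refl

incidence-scale : ∀ w e ℓ → incidence w e ℓ ≡ incidence w e 1 * ℓ
incidence-scale w (a , b) ℓ with does (w ≟V a) | does (w ≟V b)
... | true | _ = sym (+-identityʳ ℓ)
... | false | true = sym (+-identityʳ ℓ)
... | false | false = refl

mirror : ℕ → ℕ → ℕ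
mirror k i = suc (2 * k) ∸ i

private
  1+2k≡k+1+k : ∀ k → suc (2 * k) ≡ k + suc k
  1+2k≡k+1+k = solve-∀

module _ {k : ℕ} where

  k<mirror : ∀ {i} → i ≤ k → k < mirror k i
  k<mirror {i} i≤k = begin-strict
    k               <⟨ n<1+n k ⟩
    suc k           ≡⟨ sym (m+n∸m≡n k (suc k)) ⟩
    k + suc k ∸ k   ≡⟨ cong (_∸ k) (sym (1+2k≡k+1+k k)) ⟩
    suc (2 * k) ∸ k ≤⟨ ∸-monoʳ-≤ (suc (2 * k)) i≤k ⟩
    mirror k i      ∎
    where open ≤-Reasoning

  ≢mirror : ∀ {i i′} → i ≤ k → i′ ≤ k → i′ ≢ mirror k i
  ≢mirror i≤k i′≤k i′≡ = <-irrefl i′≡ (≤-<-trans i′≤k (k<mirror i≤k))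

  ≤2k : ∀ {i} → i ≤ k → i ≤ 2 * k
  ≤2k i≤k = ≤-trans i≤k (m≤m+n _ _)

  mirror-involutive : ∀ {i} → i ≤ 2 * k → mirror k (mirror k i) ≡ i
  mirror-involutive i≤2k = m∸[m∸n]≡n (m≤n⇒m≤1+n i≤2k)

  mirror-injective : ∀ {i i′} → i ≤ 2 * k → i′ ≤ 2 * k → mirror k i ≡ mirror k i′ → i ≡ i′
  mirror-injective i≤ i′≤ eq =
    trans (sym (mirror-involutive i≤)) (trans (cong (mirror k) eq) (mirror-involutive i′≤))

  mirror≥1 : ∀ {i} → i ≤ k → 1 ≤ mirror k i
  mirror≥1 i≤k = ≤-trans (s≤s z≤n) (k<mirror i≤k)

  mirror≤2k : ∀ {i} → 1 ≤ i → mirror k i ≤ 2 * k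
  mirror≤2k {suc i} _ = m∸n≤m (2 * k) i

  mirror-upper : ∀ {i} → k < i → i ≤ 2 * k → mirror k i ≤ k
  mirror-upper {i} k<i i≤2k = m≤n+o⇒m∸n≤o (suc (2 * k)) i
    (≤-trans (≤-reflexive (trans (1+2k≡k+1+k k) (+-comm k (suc k)))) (+-monoˡ-≤ k k<i))

module Graph (n r s : ℕ) where

  k : ℕ
  k = r * s

  quad : ℕ → ℕ → ℕ → List (V × V)
  quad b i j = (u i , y b j) ∷ (v (mirror k i) , y b j) ∷ (v i , z b j) ∷ (u (mirror k i) , z b j) ∷ []

  block : ℕ → List ℕ
  block b = fromTo (suc ((b ∸ 1) * s)) (b * s)

  E : List (V × V)
  E = edges n r s

  ∑-edges : (g : V × V → ℕ) → ∑ E g ≡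
    ∑ (fromTo 1 (2 * k)) (λ i → g (u i , v i)) +
    ∑ (fromTo 1 r) (λ b → ∑ (block b) (λ i → ∑ (fromTo 1 (2 * n)) (λ j → ∑ (quad b i j) g)))
  ∑-edges g = trans (∑-++ (map (λ i → u i , v i) (fromTo 1 (2 * k))) _ g)
    (cong₂ _+_ (∑-map (λ i → u i , v i) (fromTo 1 (2 * k)) g)
      (trans (∑-concatMap _ (fromTo 1 r) g)
        (∑-cong (fromTo 1 r) (λ b → trans (∑-concatMap _ (block b) g)
          (∑-cong (block b) (λ i → ∑-concatMap (quad b i) (fromTo 1 (2 * n)) g))))))

  All-edges : (P : V × V → Set) →
    (∀ i → 1 ≤ i → i ≤ 2 * k → P (u i , v i)) →
    (∀ b i j → 1 ≤ b → b ≤ r → suc ((b ∸ 1) * s) ≤ i → i ≤ b * s → 1 ≤ j → j ≤ 2 * n → All P (quad b i j)) →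
    All P E
  All-edges P matching quads = All.++⁺ (All.map⁺ (All-fromTo 1 (2 * k) matching))
    (All-concatMap _ (fromTo 1 r) (All-fromTo 1 r (λ b b≥1 b≤r →
      All-concatMap _ (block b) (All-fromTo _ _ (λ i i≥ i≤ →
        All-concatMap (quad b i) (fromTo 1 (2 * n)) (All-fromTo 1 (2 * n) (λ j j≥1 j≤2n →
          quads b i j b≥1 b≤r i≥ i≤ j≥1 j≤2n)))))))

  matching∈edges : ∀ i → 1 ≤ i → i ≤ 2 * k → (u i , v i) ∈ E
  matching∈edges i i≥1 i≤2k = ∈-++⁺ˡ (∈-map⁺ (λ i → u i , v i) (∈-fromTo 1 (2 * k) i i≥1 i≤2k))

  quad⊆edges : ∀ b i j {e} → 1 ≤ b → b ≤ r → suc ((b ∸ 1) * s) ≤ i → i ≤ b * s → 1 ≤ j → j ≤ 2 * n →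
    e ∈ quad b i j → e ∈ E
  quad⊆edges b i j b≥1 b≤r i≥ i≤ j≥1 j≤2n e∈ = ∈-++⁺ʳ (map (λ i → u i , v i) (fromTo 1 (2 * k)))
    (∈-concatMap _ (fromTo 1 r)
      (∈-concatMap _ (block b) (∈-concatMap (quad b i) (fromTo 1 (2 * n)) e∈ (∈-fromTo 1 (2 * n) j j≥1 j≤2n))
        (∈-fromTo _ _ i i≥ i≤))
      (∈-fromTo 1 r b b≥1 b≤r))

  Vs : List V
  Vs = vertices n r s

  private
    yz : ℕ → List V
    yz b = map (y b) (fromTo 1 (2 * n)) ++ map (z b) (fromTo 1 (2 * n))

    yz⊆Vs : ∀ {b w} → 1 ≤ b → b ≤ r → w ∈ yz b → w ∈ Vs
    yz⊆Vs {b} b≥1 b≤r w∈ = ∈-++⁺ʳ (map u (fromTo 1 (2 * k))) (∈-++⁺ʳ (map v (fromTo 1 (2 * k)))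
      (∈-concatMap yz (fromTo 1 r) w∈ (∈-fromTo 1 r b b≥1 b≤r)))

  All-vertices : (P : V → Set) →
    (∀ i → 1 ≤ i → i ≤ 2 * k → P (u i)) → (∀ i → 1 ≤ i → i ≤ 2 * k → P (v i)) →
    (∀ b j → 1 ≤ b → b ≤ r → 1 ≤ j → j ≤ 2 * n → P (y b j) × P (z b j)) → All P Vs
  All-vertices P pu pv pyz = All.++⁺ (All.map⁺ (All-fromTo 1 (2 * k) pu)) (All.++⁺ (All.map⁺ (All-fromTo 1 (2 * k) pv))
    (All-concatMap yz (fromTo 1 r) (All-fromTo 1 r (λ b b≥1 b≤r →
      All.++⁺ (All.map⁺ (All-fromTo 1 (2 * n) (λ j j≥1 j≤2n → proj₁ (pyz b j b≥1 b≤r j≥1 j≤2n))))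
              (All.map⁺ (All-fromTo 1 (2 * n) (λ j j≥1 j≤2n → proj₂ (pyz b j b≥1 b≤r j≥1 j≤2n))))))))

  u∈Vs : ∀ i → 1 ≤ i → i ≤ 2 * k → u i ∈ Vs
  u∈Vs i i≥1 i≤2k = ∈-++⁺ˡ (∈-map⁺ u (∈-fromTo 1 (2 * k) i i≥1 i≤2k))

  v∈Vs : ∀ i → 1 ≤ i → i ≤ 2 * k → v i ∈ Vs
  v∈Vs i i≥1 i≤2k = ∈-++⁺ʳ (map u (fromTo 1 (2 * k))) (∈-++⁺ˡ (∈-map⁺ v (∈-fromTo 1 (2 * k) i i≥1 i≤2k)))

  y∈Vs : ∀ b j → 1 ≤ b → b ≤ r → 1 ≤ j → j ≤ 2 * n → y b j ∈ Vs
  y∈Vs b j b≥1 b≤r j≥1 j≤2n = yz⊆Vs b≥1 b≤r (∈-++⁺ˡ (∈-map⁺ (y b) (∈-fromTo 1 (2 * n) j j≥1 j≤2n)))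

  z∈Vs : ∀ b j → 1 ≤ b → b ≤ r → 1 ≤ j → j ≤ 2 * n → z b j ∈ Vs
  z∈Vs b j b≥1 b≤r j≥1 j≤2n = yz⊆Vs b≥1 b≤r (∈-++⁺ʳ (map (y b) (fromTo 1 (2 * n))) (∈-map⁺ (z b) (∈-fromTo 1 (2 * n) j j≥1 j≤2n)))

  block≡range : ∀ b → block (suc b) ≡ range (suc (b * s)) s
  block≡range b = trans (fromTo≡range (suc (b * s)) (suc b * s)) (cong (range (suc (b * s))) (m+n∸n≡m s (b * s)))

  ∑-blocks : (g : ℕ → ℕ) → ∑ (fromTo 1 r) (λ b → ∑ (block b) g) ≡ ∑ (range 1 k) g
  ∑-blocks g = trans (cong (λ bs → ∑ bs (λ b → ∑ (block b) g)) (fromTo≡range 1 r)) (from 0 r)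
    where
    from : ∀ t m → ∑ (range (suc t) m) (λ b → ∑ (block b) g) ≡ ∑ (range (suc (t * s)) (m * s)) g
    from t zero = refl
    from t (suc m) = begin
      ∑ (block (suc t)) g + ∑ (range (suc (suc t)) m) (λ b → ∑ (block b) g)
        ≡⟨ cong₂ _+_ (cong (λ is → ∑ is g) (block≡range t)) (from (suc t) m) ⟩
      ∑ (range (suc (t * s)) s) g + ∑ (range (suc (s + t * s)) (m * s)) g
        ≡⟨ cong (λ a → ∑ (range (suc (t * s)) s) g + ∑ (range (suc a) (m * s)) g) (+-comm s (t * s)) ⟩
      ∑ (range (suc (t * s)) s) g + ∑ (range (suc (t * s) + s) (m * s)) g
        ≡⟨ sym (∑-++ (range (suc (t * s)) s) _ g) ⟩
      ∑ (range (suc (t * s)) s ++ range (suc (t * s) + s) (m * s)) g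
        ≡⟨ cong (λ is → ∑ is g) (sym (range-++ (suc (t * s)) s (m * s))) ⟩
      ∑ (range (suc (t * s)) (s + m * s)) g ∎
      where open ≡-Reasoning

  block-of : ∀ i → 1 ≤ i → i ≤ k →
    Σ ℕ λ b → (1 ≤ b) × (b ≤ r) × (suc ((b ∸ 1) * s) ≤ i) × (i ≤ b * s)
  block-of i = go r i
    where
    go : ∀ r′ i → 1 ≤ i → i ≤ r′ * s → Σ ℕ λ b → (1 ≤ b) × (b ≤ r′) × (suc ((b ∸ 1) * s) ≤ i) × (i ≤ b * s)
    go zero (suc i) _ ()
    go (suc r′) i i≥1 i≤ with i ≤? s
    ... | yes i≤s = 1 , ≤-refl , s≤s z≤n , i≥1 , subst (i ≤_) (sym (+-identityʳ s)) i≤s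
    ... | no i≰s with go r′ (i ∸ s) (m<n⇒0<n∸m (≰⇒> i≰s)) (m≤n+o⇒m∸n≤o i s i≤)
    ...   | suc b , _ , b≤r′ , lo , hi = suc (suc b) , s≤s z≤n , s≤s b≤r′ ,
            ≤-trans (≤-reflexive (cong suc (+-comm s (b * s)))) (≤-trans (+-monoˡ-≤ s lo) (≤-reflexive (m∸n+n≡m (<⇒≤ (≰⇒> i≰s))))) ,
            subst (_≤ suc (suc b) * s) (m+[n∸m]≡n (<⇒≤ (≰⇒> i≰s))) (+-monoʳ-≤ s hi)

m+o≡n⇒m≤n : ∀ {m n} o → m + o ≡ n → m ≤ n
m+o≡n⇒m≤n o refl = m≤m+n _ o

≢-multiple : ∀ {q c x} → q * c < x → x < suc q * c → ∀ t → x ≢ t * c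
≢-multiple {q} {c} qc<x x<[1+q]c t refl =
  <⇒≱ (*-cancelʳ-< c q t qc<x) (s≤s⁻¹ (*-cancelʳ-< c t (suc q) x<[1+q]c))

-- Polynomial identities behind the label arithmetic, with n = 1 + m and, where a bound
-- 1 ≤ i ≤ k is involved, i = 1 + i′ and k = i + e.  They are opaque: otherwise the type
-- checker unfolds the solver's proof terms where they are used, which is prohibitively slow.
private opaque
  two-suc : ∀ m → 2 * suc m ≡ suc (suc (2 * m))
  two-suc = solve-∀

  C-id : ∀ k m → suc ((2 * k + 4 * (k * suc m)) + (2 * k + 4 * (k * suc m))) ≡ ((2 * k + 4 * (k * suc m)) + 4 * (k * suc m)) + suc (2 * k)
  C-id = solve-∀

  P-id : ∀ k m → k + (k + 4 * (k * suc m)) ≡ 2 * k + 4 * (k * suc m)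
  P-id = solve-∀

  uLabel₁-lower-id : ∀ i′ e m → suc (2 * (suc i′ + e)) + 2 * suc i′ + (suc i′ + 3 * e + 4 * ((suc i′ + e) * m) + 1) ≡ (suc i′ + e) + 4 * ((suc i′ + e) * suc m) + 2
  uLabel₁-lower-id = solve-∀

  uLabel₁-upper-id : ∀ i′ e m → ((suc i′ + e) + 4 * ((suc i′ + e) * suc m) + 2) + (3 + 5 * i′ + 5 * e + 4 * ((suc i′ + e) * m)) ≡ (2 * (suc i′ + e) + 4 * ((suc i′ + e) * suc m)) + 4 * ((suc i′ + e) * suc m)
  uLabel₁-upper-id = solve-∀

  uLabel₂-lower-id : ∀ i′ e m → suc (2 * (suc i′ + e)) + (i′ + 4 * ((suc i′ + e) * suc m) + 3 * (suc i′ + e)) ≡ (2 * (suc i′ + e) + 4 * ((suc i′ + e) * suc m)) + 3 * (suc i′ + e) + suc i′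
  uLabel₂-lower-id = solve-∀

  uLabel₂-upper-id : ∀ i′ e m → (2 * (suc i′ + e) + 4 * ((suc i′ + e) * suc m)) + 3 * (suc i′ + e) + suc i′ + (e + 4 * ((suc i′ + e) * m)) ≡ (2 * (suc i′ + e) + 4 * ((suc i′ + e) * suc m)) + 4 * ((suc i′ + e) * suc m)
  uLabel₂-upper-id = solve-∀

  vLabel₁-lower-id : ∀ i′ e m → suc (2 * (suc i′ + e)) + (4 * i′ + 3 + 3 * e + 4 * ((suc i′ + e) * m)) ≡ (suc i′ + e) + 4 * ((suc i′ + e) * suc m) + suc i′
  vLabel₁-lower-id = solve-∀

  vLabel₁-upper-id : ∀ i′ e m → (suc i′ + e) + 4 * ((suc i′ + e) * suc m) + suc i′ + (e + 4 * ((suc i′ + e) * suc m)) ≡ (2 * (suc i′ + e) + 4 * ((suc i′ + e) * suc m)) + 4 * ((suc i′ + e) * suc m)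
  vLabel₁-upper-id = solve-∀

  vLabel₂-lower-id : ∀ i′ e m → suc (2 * (suc i′ + e)) + ((suc i′ + e) + 2 * suc i′) + (3 * e + 1 + i′ + 4 * ((suc i′ + e) * m)) ≡ suc (2 * (suc i′ + e) + 4 * ((suc i′ + e) * suc m))
  vLabel₂-lower-id = solve-∀

  vLabel₂-upper-id : ∀ i′ e m → suc (2 * (suc i′ + e) + 4 * ((suc i′ + e) * suc m)) + (3 + 4 * i′ + 4 * e + 4 * ((suc i′ + e) * m)) ≡ (2 * (suc i′ + e) + 4 * ((suc i′ + e) * suc m)) + 4 * ((suc i′ + e) * suc m)
  vLabel₂-upper-id = solve-∀

  tail₀-lower-id : ∀ k m b → suc (2 * k) + (4 * (k * suc m) + b + 1) ≡ (2 * k + 4 * (k * suc m)) + b + 2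
  tail₀-lower-id = solve-∀

  uTail₁-lower-id : ∀ k b → suc (2 * k) + b ≡ 2 * k + (b + 1)
  uTail₁-lower-id = solve-∀

  vTail₁-lower-id : ∀ k b → suc (2 * k) + (b + 3) ≡ 2 * k + (b + 4)
  vTail₁-lower-id = solve-∀

  offset-id : ∀ k l i′ → 4 * (k * l) + 4 * i′ + 4 ≡ 4 * (k * l + suc i′)
  offset-id = solve-∀

  T-id : ∀ k m → 4 * (k * suc m) ≡ 4 * (k * m + k)
  T-id = solve-∀

  pair-id : ∀ p b c → p + b + 2 + c ≡ p + 2 + (b + c)
  pair-id = solve-∀

  1+[p+p]-id : ∀ p → p + 2 + p ≡ suc (suc (p + p))
  1+[p+p]-id = solve-∀

  uRow-rearrange : ∀ k m i t → (k + i) + (t + (((2 * k + 4 * (k * suc m)) + 3 * k + i) + m * suc (suc ((2 * k + 4 * (k * suc m)) + (2 * k + 4 * (k * suc m)))))) ≡ (t + 2 * i) + (k + (2 * k + 4 * (k * suc m)) + 3 * k + m * suc (suc ((2 * k + 4 * (k * suc m)) + (2 * k + 4 * (k * suc m)))))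
  uRow-rearrange = solve-∀

  uRow-id : ∀ k m → (k + 4 * (k * suc m) + 2) + (k + (2 * k + 4 * (k * suc m)) + 3 * k + m * suc (suc ((2 * k + 4 * (k * suc m)) + (2 * k + 4 * (k * suc m))))) ≡ suc m * suc ((2 * k + 4 * (k * suc m)) + (2 * k + 4 * (k * suc m))) + (3 * k + 1 + m)
  uRow-id = solve-∀

  vRow-rearrange : ∀ k m i t → (k + i) + ((k + 4 * (k * suc m) + i) + (t + m * ((2 * k + 4 * (k * suc m)) + (2 * k + 4 * (k * suc m))))) + (k + m) ≡ (t + (k + 2 * i)) + (2 * k + 4 * (k * suc m) + m * ((2 * k + 4 * (k * suc m)) + (2 * k + 4 * (k * suc m))) + m)
  vRow-rearrange = solve-∀

  vRow-id : ∀ k m → suc (2 * k + 4 * (k * suc m)) + (2 * k + 4 * (k * suc m) + m * ((2 * k + 4 * (k * suc m)) + (2 * k + 4 * (k * suc m))) + m) ≡ suc m * suc ((2 * k + 4 * (k * suc m)) + (2 * k + 4 * (k * suc m)))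
  vRow-id = solve-∀

  uSum+vSum-id : ∀ k m c → suc m * c + (3 * k + 1 + m) + suc m * c ≡ suc (2 * k) + 2 * suc m * c + (k + m)
  uSum+vSum-id = solve-∀

  uSum-excess-id : ∀ k′ m → suc (3 * suc k′ + 1 + m) + (8 + 9 * k′ + 8 * (k′ * m) + 7 * m) ≡ suc ((2 * suc k′ + 4 * (suc k′ * suc m)) + (2 * suc k′ + 4 * (suc k′ * suc m)))
  uSum-excess-id = solve-∀

  vSum-deficit-id : ∀ k′ m → suc (suc k′ + m) + (11 + 11 * k′ + 8 * (k′ * m) + 7 * m) ≡ suc ((2 * suc k′ + 4 * (suc k′ * suc m)) + (2 * suc k′ + 4 * (suc k′ * suc m)))
  vSum-deficit-id = solve-∀

  uLabel₁-cover-id : ∀ a q k → suc (a + (suc k + q * 2)) ≡ (a + 2 * suc q) + k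
  uLabel₁-cover-id = solve-∀

  1+P+1-id : ∀ k m → (k + 4 * (k * suc m) + 2) + k ≡ suc (suc (2 * k + 4 * (k * suc m)))
  1+P+1-id = solve-∀

  vLabel₂-cover-id : ∀ q k → k + 2 * suc q ≡ suc k + (q * 2 + 1)
  vLabel₂-cover-id = solve-∀

  tail-cover-id : ∀ k l′ i′ ρ → suc (4 * k) + ((l′ * k + i′) * 4 + ρ) ≡ suc ρ + (4 * (k * suc l′) + 4 * i′)
  tail-cover-id = solve-∀

  T≡4k+4kn′ : ∀ k m → 4 * (k * suc m) ≡ 4 * k + k * m * 4
  T≡4k+4kn′ = solve-∀

  tail-index-id : ∀ l′ → 3 + (l′ * 2 + 1) ≡ 2 * suc (suc l′)
  tail-index-id = solve-∀

  3k+k≡4k : ∀ k → 3 * k + k ≡ 4 * k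
  3k+k≡4k = solve-∀

  k+2k≡3k : ∀ k → k + k * 2 ≡ 3 * k
  k+2k≡3k = solve-∀

  length-edges-id : ∀ r s m → 2 * (r * s) * 1 + r * (s * (2 * suc m * 4)) ≡ (2 * (r * s) + 4 * ((r * s) * suc m)) + 4 * ((r * s) * suc m)
  length-edges-id = solve-∀

divMod : ∀ x d .{{_ : NonZero d}} a → x < a * d → Σ ℕ λ q → Σ ℕ λ ρ → (q < a) × (ρ < d) × (x ≡ q * d + ρ)
divMod x d a x<ad = x / d , x % d , m<n*o⇒m/o<n x<ad , m%n<n x d , trans (m≡m%n+[m/n]*n x d) (+-comm (x % d) _)

module Labels (k n′ : ℕ) where

  n : ℕ
  n = suc n′

  T : ℕ
  T = 4 * (k * n)

  P : ℕ
  P = 2 * k + T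

  Q : ℕ
  Q = P + T

  C : ℕ
  C = suc (P + P)

  matchingLabel : ℕ → ℕ
  matchingLabel i = if does (i ≤? k) then k + i else i ∸ k

  offset : ℕ → ℕ → ℕ
  offset l i = 4 * (k * l) + 4 * (i ∸ 1)

  uTail : ℕ → ℕ → ℕ → ℕ
  uTail i l zero = P + offset l i + 2
  uTail i l (suc zero) = P ∸ offset l i
  uTail i l (suc (suc j)) = uTail i (suc l) j

  vTail : ℕ → ℕ → ℕ → ℕ
  vTail i l zero = P + offset l i + 3
  vTail i l (suc zero) = P ∸ (offset l i + 3)
  vTail i l (suc (suc j)) = vTail i (suc l) j

  uLabel : ℕ → ℕ → ℕ
  uLabel i zero = 0
  uLabel i (suc zero) = (k + T + 2) ∸ 2 * i
  uLabel i (suc (suc zero)) = P + 3 * k + i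
  uLabel i (suc (suc (suc j))) = uTail i 1 j

  vLabel : ℕ → ℕ → ℕ
  vLabel i zero = 0
  vLabel i (suc zero) = P ∸ k + i
  vLabel i (suc (suc zero)) = suc P ∸ (k + 2 * i)
  vLabel i (suc (suc (suc j))) = vTail i 1 j

  -- A label ℓ on u_i y_{b,j} or v_i z_{b,j} (i ≤ k) is paired with C − ℓ on the edge from the
  -- mirror vertex, of index 2k + 1 − i, to the same y_{b,j} or z_{b,j}.
  lab : V × V → ℕ
  lab (u i , v _) = matchingLabel i
  lab (u i , y b j) = uLabel i j
  lab (v i , y b j) = C ∸ uLabel (mirror k i) j
  lab (v i , z b j) = vLabel i j
  lab (u i , z b j) = C ∸ vLabel (mirror k i) j
  lab _ = 0

  High : ℕ → Set
  High x = (suc (2 * k) ≤ x) × (x ≤ Q)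

  private
    decompose : ∀ {i} → 1 ≤ i → i ≤ k → Σ ℕ λ i′ → Σ ℕ λ e → (i ≡ suc i′) × (k ≡ suc i′ + e)
    decompose {suc i′} _ i≤k = i′ , k ∸ suc i′ , refl , sym (m+[n∸m]≡n i≤k)

  C≡Q+1+2k : C ≡ Q + suc (2 * k)
  C≡Q+1+2k = C-id k n′

  Q≤C : Q ≤ C
  Q≤C = subst (Q ≤_) (sym C≡Q+1+2k) (m≤m+n Q _)

  High⇒≤C : ∀ {x} → High x → x ≤ C
  High⇒≤C (_ , x≤Q) = ≤-trans x≤Q Q≤C

  High-complement : ∀ {x} → High x → High (C ∸ x)
  High-complement {x} (lo , hi) =
    m+n≤o⇒m≤o∸n (suc (2 * k)) (subst (suc (2 * k) + x ≤_) (sym C≡Q+1+2k)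
      (subst (_≤ Q + suc (2 * k)) (+-comm x _) (+-monoˡ-≤ (suc (2 * k)) hi))) ,
    m≤n+o⇒m∸n≤o C x (subst (_≤ x + Q) (sym C≡Q+1+2k) (subst (Q + suc (2 * k) ≤_) (+-comm Q x) (+-monoʳ-≤ Q lo)))

  k≤P : k ≤ P
  k≤P = m+o≡n⇒m≤n _ (P-id k n′)

  P∸k≡k+T : P ∸ k ≡ k + T
  P∸k≡k+T = trans (cong (_∸ k) (sym (P-id k n′))) (m+n∸m≡n k _)

  1+2k+2i≤k+T+2 : ∀ {i} → 1 ≤ i → i ≤ k → suc (2 * k) + 2 * i ≤ k + T + 2
  1+2k+2i≤k+T+2 i≥1 i≤k with decompose i≥1 i≤k
  ... | i′ , e , refl , refl = m+o≡n⇒m≤n _ (uLabel₁-lower-id i′ e n′)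

  uLabel₁-high : ∀ {i} → 1 ≤ i → i ≤ k → High (uLabel i 1)
  uLabel₁-high {i} i≥1 i≤k = m+n≤o⇒m≤o∸n (suc (2 * k)) (1+2k+2i≤k+T+2 i≥1 i≤k) , ≤-trans (m∸n≤m _ (2 * i)) upper
    where
    upper : k + T + 2 ≤ Q
    upper with decompose i≥1 i≤k
    ... | i′ , e , refl , refl = m+o≡n⇒m≤n _ (uLabel₁-upper-id i′ e n′)

  uLabel₂-high : ∀ {i} → 1 ≤ i → i ≤ k → High (uLabel i 2)
  uLabel₂-high i≥1 i≤k with decompose i≥1 i≤k
  ... | i′ , e , refl , refl = m+o≡n⇒m≤n _ (uLabel₂-lower-id i′ e n′) , m+o≡n⇒m≤n _ (uLabel₂-upper-id i′ e n′)

  vLabel₁-high : ∀ {i} → 1 ≤ i → i ≤ k → High (vLabel i 1)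
  vLabel₁-high {i} i≥1 i≤k = subst High (cong (_+ i) (sym P∸k≡k+T)) bounds
    where
    bounds : High (k + T + i)
    bounds with decompose i≥1 i≤k
    ... | i′ , e , refl , refl = m+o≡n⇒m≤n _ (vLabel₁-lower-id i′ e n′) , m+o≡n⇒m≤n _ (vLabel₁-upper-id i′ e n′)

  1+2k+[k+2i]≤1+P : ∀ {i} → 1 ≤ i → i ≤ k → suc (2 * k) + (k + 2 * i) ≤ suc P
  1+2k+[k+2i]≤1+P i≥1 i≤k with decompose i≥1 i≤k
  ... | i′ , e , refl , refl = m+o≡n⇒m≤n _ (vLabel₂-lower-id i′ e n′)

  vLabel₂-high : ∀ {i} → 1 ≤ i → i ≤ k → High (vLabel i 2)
  vLabel₂-high {i} i≥1 i≤k = m+n≤o⇒m≤o∸n (suc (2 * k)) (1+2k+[k+2i]≤1+P i≥1 i≤k) , ≤-trans (m∸n≤m (suc P) (k + 2 * i)) upper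
    where
    upper : suc P ≤ Q
    upper with decompose i≥1 i≤k
    ... | i′ , e , refl , refl = m+o≡n⇒m≤n _ (vLabel₂-upper-id i′ e n′)

  offset+4≤T : ∀ {l i} → l ≤ n′ → 1 ≤ i → i ≤ k → offset l i + 4 ≤ T
  offset+4≤T {l} {suc i′} l≤n′ _ i≤k =
    subst₂ _≤_ (sym (offset-id k l i′)) (sym (T-id k n′)) (*-monoʳ-≤ 4 (+-mono-≤ (*-monoʳ-≤ k l≤n′) i≤k))

  private
    P+b+2-high : ∀ {b} → b + 4 ≤ T → High (P + b + 2)
    P+b+2-high {b} b+4≤T = m+o≡n⇒m≤n _ (tail₀-lower-id k n′ b) ,
      subst (_≤ Q) (sym (+-assoc P b 2)) (+-monoʳ-≤ P (≤-trans (+-monoʳ-≤ b (s≤s (s≤s z≤n))) b+4≤T))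

    P+b+3-high : ∀ {b} → b + 4 ≤ T → High (P + b + 3)
    P+b+3-high {b} b+4≤T = ≤-trans (proj₁ (P+b+2-high b+4≤T)) (+-monoʳ-≤ (P + b) (s≤s (s≤s z≤n))) ,
      subst (_≤ Q) (sym (+-assoc P b 3)) (+-monoʳ-≤ P (≤-trans (+-monoʳ-≤ b (s≤s (s≤s (s≤s z≤n)))) b+4≤T))

    P∸b-high : ∀ {b} → b + 4 ≤ T → High (P ∸ b)
    P∸b-high {b} b+4≤T =
      m+n≤o⇒m≤o∸n (suc (2 * k)) (subst (_≤ P) (sym (uTail₁-lower-id k b)) (+-monoʳ-≤ (2 * k) (≤-trans (+-monoʳ-≤ b (s≤s z≤n)) b+4≤T))) ,
      ≤-trans (m∸n≤m P b) (m≤m+n P _)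

    P∸[b+3]-high : ∀ {b} → b + 4 ≤ T → High (P ∸ (b + 3))
    P∸[b+3]-high {b} b+4≤T =
      m+n≤o⇒m≤o∸n (suc (2 * k)) (subst (_≤ P) (sym (vTail₁-lower-id k b)) (+-monoʳ-≤ (2 * k) b+4≤T)) ,
      ≤-trans (m∸n≤m P (b + 3)) (m≤m+n P _)

    head≤n′ : ∀ {l m} → l + suc m ≤ n → l ≤ n′
    head≤n′ {l} {m} l+m≤n = s≤s⁻¹ (≤-trans (s≤s (m≤m+n l m)) (subst (_≤ n) (+-suc l m) l+m≤n))

    3+j≤2[1+m]⇒j<2m : ∀ {j m} → suc (suc (suc j)) ≤ 2 * suc m → j < 2 * m
    3+j≤2[1+m]⇒j<2m {j} {m} h = s≤s⁻¹ (s≤s⁻¹ (subst (suc (suc (suc j)) ≤_) (two-suc m) h))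

  uTail-high : ∀ {i} → 1 ≤ i → i ≤ k → ∀ m l j → j < 2 * m → l + m ≤ n → High (uTail i l j)
  uTail-high i≥1 i≤k zero l j () _
  uTail-high i≥1 i≤k (suc m) l zero _ l+m≤n = P+b+2-high (offset+4≤T (head≤n′ l+m≤n) i≥1 i≤k)
  uTail-high i≥1 i≤k (suc m) l (suc zero) _ l+m≤n = P∸b-high (offset+4≤T (head≤n′ l+m≤n) i≥1 i≤k)
  uTail-high i≥1 i≤k (suc m) l (suc (suc j)) j< l+m≤n =
    uTail-high i≥1 i≤k m (suc l) j (3+j≤2[1+m]⇒j<2m j<) (subst (_≤ n) (+-suc l m) l+m≤n)

  vTail-high : ∀ {i} → 1 ≤ i → i ≤ k → ∀ m l j → j < 2 * m → l + m ≤ n → High (vTail i l j)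
  vTail-high i≥1 i≤k zero l j () _
  vTail-high i≥1 i≤k (suc m) l zero _ l+m≤n = P+b+3-high (offset+4≤T (head≤n′ l+m≤n) i≥1 i≤k)
  vTail-high i≥1 i≤k (suc m) l (suc zero) _ l+m≤n = P∸[b+3]-high (offset+4≤T (head≤n′ l+m≤n) i≥1 i≤k)
  vTail-high i≥1 i≤k (suc m) l (suc (suc j)) j< l+m≤n =
    vTail-high i≥1 i≤k m (suc l) j (3+j≤2[1+m]⇒j<2m j<) (subst (_≤ n) (+-suc l m) l+m≤n)

  uLabel-high : ∀ {i j} → 1 ≤ i → i ≤ k → 1 ≤ j → j ≤ 2 * n → High (uLabel i j)
  uLabel-high {j = suc zero} i≥1 i≤k _ _ = uLabel₁-high i≥1 i≤k
  uLabel-high {j = suc (suc zero)} i≥1 i≤k _ _ = uLabel₂-high i≥1 i≤k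
  uLabel-high {j = suc (suc (suc j))} i≥1 i≤k _ j≤2n = uTail-high i≥1 i≤k n′ 1 j (3+j≤2[1+m]⇒j<2m j≤2n) ≤-refl

  vLabel-high : ∀ {i j} → 1 ≤ i → i ≤ k → 1 ≤ j → j ≤ 2 * n → High (vLabel i j)
  vLabel-high {j = suc zero} i≥1 i≤k _ _ = vLabel₁-high i≥1 i≤k
  vLabel-high {j = suc (suc zero)} i≥1 i≤k _ _ = vLabel₂-high i≥1 i≤k
  vLabel-high {j = suc (suc (suc j))} i≥1 i≤k _ j≤2n = vTail-high i≥1 i≤k n′ 1 j (3+j≤2[1+m]⇒j<2m j≤2n) ≤-refl

  private
    range-2+ : ∀ a m → range a (2 * suc m) ≡ a ∷ suc a ∷ range (suc (suc a)) (2 * m)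
    range-2+ a m = cong (range a) (two-suc m)

  uTail-pairs : ∀ {i} → 1 ≤ i → i ≤ k → ∀ m l → l + m ≤ n → ∑ (range 0 (2 * m)) (uTail i l) ≡ m * suc C
  uTail-pairs i≥1 i≤k zero l _ = refl
  uTail-pairs {i} i≥1 i≤k (suc m) l l+m≤n = begin
    ∑ (range 0 (2 * suc m)) (uTail i l)                                   ≡⟨ cong (λ js → ∑ js (uTail i l)) (range-2+ 0 m) ⟩
    uTail i l 0 + (uTail i l 1 + ∑ (range 2 (2 * m)) (uTail i l))         ≡⟨ cong (λ t → uTail i l 0 + (uTail i l 1 + t)) (∑-range-shift 2 0 (2 * m) (uTail i l)) ⟩
    uTail i l 0 + (uTail i l 1 + ∑ (range 0 (2 * m)) (uTail i (suc l)))  ≡⟨ cong (λ t → uTail i l 0 + (uTail i l 1 + t)) (uTail-pairs i≥1 i≤k m (suc l) (subst (_≤ n) (+-suc l m) l+m≤n)) ⟩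
    uTail i l 0 + (uTail i l 1 + m * suc C)                               ≡⟨ sym (+-assoc (uTail i l 0) _ _) ⟩
    P + b + 2 + (P ∸ b) + m * suc C                                       ≡⟨ cong (_+ m * suc C) pair ⟩
    suc C + m * suc C                                                     ∎
    where
    open ≡-Reasoning
    b = offset l i
    pair : P + b + 2 + (P ∸ b) ≡ suc C
    pair = trans (pair-id P b (P ∸ b)) (trans (cong (P + 2 +_) (m+[n∸m]≡n (≤-trans (m≤m+n b 4)
             (≤-trans (offset+4≤T (head≤n′ l+m≤n) i≥1 i≤k) (m≤n+m T (2 * k)))))) (1+[p+p]-id P))

  vTail-pairs : ∀ {i} → 1 ≤ i → i ≤ k → ∀ m l → l + m ≤ n → ∑ (range 0 (2 * m)) (vTail i l) ≡ m * (P + P)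
  vTail-pairs i≥1 i≤k zero l _ = refl
  vTail-pairs {i} i≥1 i≤k (suc m) l l+m≤n = begin
    ∑ (range 0 (2 * suc m)) (vTail i l)                                   ≡⟨ cong (λ js → ∑ js (vTail i l)) (range-2+ 0 m) ⟩
    vTail i l 0 + (vTail i l 1 + ∑ (range 2 (2 * m)) (vTail i l))         ≡⟨ cong (λ t → vTail i l 0 + (vTail i l 1 + t)) (∑-range-shift 2 0 (2 * m) (vTail i l)) ⟩
    vTail i l 0 + (vTail i l 1 + ∑ (range 0 (2 * m)) (vTail i (suc l)))  ≡⟨ cong (λ t → vTail i l 0 + (vTail i l 1 + t)) (vTail-pairs i≥1 i≤k m (suc l) (subst (_≤ n) (+-suc l m) l+m≤n)) ⟩
    vTail i l 0 + (vTail i l 1 + m * (P + P))                             ≡⟨ sym (+-assoc (vTail i l 0) _ _) ⟩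
    P + b + 3 + (P ∸ (b + 3)) + m * (P + P)                               ≡⟨ cong (_+ m * (P + P)) pair ⟩
    P + P + m * (P + P)                                                   ∎
    where
    open ≡-Reasoning
    b = offset l i
    pair : P + b + 3 + (P ∸ (b + 3)) ≡ P + P
    pair = trans (cong (_+ (P ∸ (b + 3))) (+-assoc P b 3)) (trans (+-assoc P (b + 3) _)
             (cong (P +_) (m+[n∸m]≡n (≤-trans (+-monoʳ-≤ b (n≤1+n 3))
               (≤-trans (offset+4≤T (head≤n′ l+m≤n) i≥1 i≤k) (m≤n+m T (2 * k)))))))

  uRow : ∀ {i} → 1 ≤ i → i ≤ k → ∑ (fromTo 1 (2 * n)) (uLabel i) ≡ uLabel i 1 + (uLabel i 2 + n′ * suc C)
  uRow {i} i≥1 i≤k = begin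
    ∑ (fromTo 1 (2 * n)) (uLabel i)                              ≡⟨ cong (λ js → ∑ js (uLabel i)) (trans (fromTo≡range 1 (2 * n)) (range-2+ 1 n′)) ⟩
    uLabel i 1 + (uLabel i 2 + ∑ (range 3 (2 * n′)) (uLabel i))  ≡⟨ cong (λ t → uLabel i 1 + (uLabel i 2 + t)) (∑-range-shift 3 0 (2 * n′) (uLabel i)) ⟩
    uLabel i 1 + (uLabel i 2 + ∑ (range 0 (2 * n′)) (uTail i 1)) ≡⟨ cong (λ t → uLabel i 1 + (uLabel i 2 + t)) (uTail-pairs i≥1 i≤k n′ 1 ≤-refl) ⟩
    uLabel i 1 + (uLabel i 2 + n′ * suc C)                       ∎
    where open ≡-Reasoning

  vRow : ∀ {i} → 1 ≤ i → i ≤ k → ∑ (fromTo 1 (2 * n)) (vLabel i) ≡ vLabel i 1 + (vLabel i 2 + n′ * (P + P))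
  vRow {i} i≥1 i≤k = begin
    ∑ (fromTo 1 (2 * n)) (vLabel i)                              ≡⟨ cong (λ js → ∑ js (vLabel i)) (trans (fromTo≡range 1 (2 * n)) (range-2+ 1 n′)) ⟩
    vLabel i 1 + (vLabel i 2 + ∑ (range 3 (2 * n′)) (vLabel i))  ≡⟨ cong (λ t → vLabel i 1 + (vLabel i 2 + t)) (∑-range-shift 3 0 (2 * n′) (vLabel i)) ⟩
    vLabel i 1 + (vLabel i 2 + ∑ (range 0 (2 * n′)) (vTail i 1)) ≡⟨ cong (λ t → vLabel i 1 + (vLabel i 2 + t)) (vTail-pairs i≥1 i≤k n′ 1 ≤-refl) ⟩
    vLabel i 1 + (vLabel i 2 + n′ * (P + P))                     ∎
    where open ≡-Reasoning

  uValue : ℕ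
  uValue = n * C + (3 * k + 1 + n′)

  vValue : ℕ
  vValue = n * C ∸ (k + n′)

  matchingLabel-low : ∀ {i} → i ≤ k → matchingLabel i ≡ k + i
  matchingLabel-low {i} i≤k = cong (λ b → if b then k + i else i ∸ k) (dec-true (i ≤? k) i≤k)

  matchingLabel-high : ∀ {i} → ¬ i ≤ k → matchingLabel i ≡ i ∸ k
  matchingLabel-high {i} i≰k = cong (λ b → if b then k + i else i ∸ k) (dec-false (i ≤? k) i≰k)

  matchingLabel-mirror : ∀ {i} → i ≤ k → matchingLabel (mirror k i) + matchingLabel i ≡ suc (2 * k)
  matchingLabel-mirror {i} i≤k = begin
    matchingLabel (mirror k i) + matchingLabel i ≡⟨ cong₂ _+_ (matchingLabel-high (<⇒≱ (k<mirror i≤k))) (matchingLabel-low i≤k) ⟩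
    mirror k i ∸ k + (k + i)                     ≡⟨ sym (+-assoc (mirror k i ∸ k) k i) ⟩
    mirror k i ∸ k + k + i                       ≡⟨ cong (_+ i) (m∸n+n≡m (<⇒≤ (k<mirror i≤k))) ⟩
    mirror k i + i                               ≡⟨ m∸n+n≡m (m≤n⇒m≤1+n (≤2k i≤k)) ⟩
    suc (2 * k)                                  ∎
    where open ≡-Reasoning

  uSum : ∀ {i} → 1 ≤ i → i ≤ k → matchingLabel i + ∑ (fromTo 1 (2 * n)) (uLabel i) ≡ uValue
  uSum {i} i≥1 i≤k = begin
    matchingLabel i + ∑ (fromTo 1 (2 * n)) (uLabel i)
      ≡⟨ cong₂ _+_ (matchingLabel-low i≤k) (uRow i≥1 i≤k) ⟩
    (k + i) + (t + (uLabel i 2 + n′ * suc C))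
      ≡⟨ uRow-rearrange k n′ i t ⟩
    (t + 2 * i) + (k + P + 3 * k + n′ * suc C)
      ≡⟨ cong (_+ (k + P + 3 * k + n′ * suc C)) (m∸n+n≡m (≤-trans (m≤n+m (2 * i) (suc (2 * k))) (1+2k+2i≤k+T+2 i≥1 i≤k))) ⟩
    (k + T + 2) + (k + P + 3 * k + n′ * suc C)
      ≡⟨ uRow-id k n′ ⟩
    uValue ∎
    where
    open ≡-Reasoning
    t = uLabel i 1

  vSum : ∀ {i} → 1 ≤ i → i ≤ k → matchingLabel i + ∑ (fromTo 1 (2 * n)) (vLabel i) ≡ vValue
  vSum {i} i≥1 i≤k = trans (cong₂ _+_ (matchingLabel-low i≤k) (vRow i≥1 i≤k))
    (trans (sym (m+n∸n≡m _ (k + n′))) (cong (_∸ (k + n′)) sum+k+n′))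
    where
    open ≡-Reasoning
    t = vLabel i 2
    sum+k+n′ : (k + i) + (vLabel i 1 + (t + n′ * (P + P))) + (k + n′) ≡ n * C
    sum+k+n′ = begin
      (k + i) + ((P ∸ k + i) + (t + n′ * (P + P))) + (k + n′)
        ≡⟨ cong (λ a → (k + i) + ((a + i) + (t + n′ * (P + P))) + (k + n′)) P∸k≡k+T ⟩
      (k + i) + ((k + T + i) + (t + n′ * (P + P))) + (k + n′)
        ≡⟨ vRow-rearrange k n′ i t ⟩
      (t + (k + 2 * i)) + (P + n′ * (P + P) + n′)
        ≡⟨ cong (_+ (P + n′ * (P + P) + n′)) (m∸n+n≡m (≤-trans (m≤n+m _ (suc (2 * k))) (1+2k+[k+2i]≤1+P i≥1 i≤k))) ⟩
      suc P + (P + n′ * (P + P) + n′)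
        ≡⟨ vRow-id k n′ ⟩
      n * C ∎

  ∑-complement : (g : ℕ → ℕ) → (∀ j → 1 ≤ j → j ≤ 2 * n → g j ≤ C) →
    ∑ (fromTo 1 (2 * n)) (λ j → C ∸ g j) + ∑ (fromTo 1 (2 * n)) g ≡ 2 * n * C
  ∑-complement g g≤C = trans (sym (∑-+ (fromTo 1 (2 * n)) (λ j → C ∸ g j) g))
    (trans (fromTo-∑-cong 1 (2 * n) (λ j j≥1 j≤2n → m∸n+n≡m (g≤C j j≥1 j≤2n))) (fromTo-∑-const (2 * n) C))

  private
    3k+1+n′<C : 1 ≤ k → 3 * k + 1 + n′ < C
    3k+1+n′<C (s≤s {n = k′} z≤n) = m+o≡n⇒m≤n _ (uSum-excess-id k′ n′)

    k+n′<C : 1 ≤ k → k + n′ < C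
    k+n′<C (s≤s {n = k′} z≤n) = m+o≡n⇒m≤n _ (vSum-deficit-id k′ n′)

  module _ (k≥1 : 1 ≤ k) where

    private
      k+n′≤nC : k + n′ ≤ n * C
      k+n′≤nC = ≤-trans (<⇒≤ (k+n′<C k≥1)) (m≤m+n C _)

    uValue+vValue : uValue + vValue ≡ suc (2 * k) + 2 * n * C
    uValue+vValue = +-cancelʳ-≡ (k + n′) _ _ (trans (+-assoc uValue vValue (k + n′))
      (trans (cong (uValue +_) (m∸n+n≡m k+n′≤nC)) (uSum+vSum-id k n′ C)))

    vValue<nC : vValue < n * C
    vValue<nC = ∸-monoʳ-< (≤-trans k≥1 (m≤m+n k n′)) k+n′≤nC

    nC<uValue : n * C < uValue
    nC<uValue = m<m+n (n * C) (≤-trans (m≤n+m 1 (3 * k)) (m≤m+n _ n′))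

    uValue≢vValue : uValue ≢ vValue
    uValue≢vValue eq = <-asym vValue<nC (subst (n * C <_) eq nC<uValue)

    uValue≢multiple : ∀ t → uValue ≢ t * C
    uValue≢multiple = ≢-multiple {q = n} nC<uValue (subst (uValue <_) (+-comm (n * C) C) (+-monoʳ-< (n * C) (3k+1+n′<C k≥1)))

    vValue≢multiple : ∀ t → vValue ≢ t * C
    vValue≢multiple = ≢-multiple {q = n′} (m+n≤o⇒m≤o∸n (suc (n′ * C)) below) vValue<nC
      where
      below : suc (n′ * C) + (k + n′) ≤ n * C
      below = subst (_≤ n * C) (+-suc (n′ * C) (k + n′)) (subst (n′ * C + suc (k + n′) ≤_) (+-comm (n′ * C) C) (+-monoʳ-≤ (n′ * C) (k+n′<C k≥1)))

    mirror-sum : ∀ {i} (g : ℕ → ℕ) {a b} → i ≤ k → (∀ j → 1 ≤ j → j ≤ 2 * n → g j ≤ C) →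
      a + b ≡ suc (2 * k) + 2 * n * C → matchingLabel i + ∑ (fromTo 1 (2 * n)) g ≡ a →
      matchingLabel (mirror k i) + ∑ (fromTo 1 (2 * n)) (λ j → C ∸ g j) ≡ b
    mirror-sum {i} g {a} {b} i≤k g≤C a+b sum-a = +-cancelʳ-≡ a _ _ (begin
      matchingLabel (mirror k i) + ∑ₙ (λ j → C ∸ g j) + a               ≡⟨ cong (matchingLabel (mirror k i) + ∑ₙ (λ j → C ∸ g j) +_) (sym sum-a) ⟩
      matchingLabel (mirror k i) + ∑ₙ (λ j → C ∸ g j) + (matchingLabel i + ∑ₙ g)
                                                                      ≡⟨ +-interchange (matchingLabel (mirror k i)) (∑ₙ (λ j → C ∸ g j)) (matchingLabel i) (∑ₙ g) ⟩
      matchingLabel (mirror k i) + matchingLabel i + (∑ₙ (λ j → C ∸ g j) + ∑ₙ g)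
                                                                      ≡⟨ cong₂ _+_ (matchingLabel-mirror i≤k) (∑-complement g g≤C) ⟩
      suc (2 * k) + 2 * n * C                                         ≡⟨ sym a+b ⟩
      a + b                                                           ≡⟨ +-comm a b ⟩
      b + a                                                           ∎)
      where
      open ≡-Reasoning
      ∑ₙ : (ℕ → ℕ) → ℕ
      ∑ₙ = ∑ (fromTo 1 (2 * n))

    mirror-uSum : ∀ {i} → 1 ≤ i → i ≤ k → matchingLabel (mirror k i) + ∑ (fromTo 1 (2 * n)) (λ j → C ∸ uLabel i j) ≡ vValue
    mirror-uSum i≥1 i≤k = mirror-sum _ i≤k (λ j j≥1 j≤2n → High⇒≤C (uLabel-high i≥1 i≤k j≥1 j≤2n)) uValue+vValue (uSum i≥1 i≤k)

    mirror-vSum : ∀ {i} → 1 ≤ i → i ≤ k → matchingLabel (mirror k i) + ∑ (fromTo 1 (2 * n)) (λ j → C ∸ vLabel i j) ≡ uValue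
    mirror-vSum i≥1 i≤k = mirror-sum _ i≤k (λ j j≥1 j≤2n → High⇒≤C (vLabel-high i≥1 i≤k j≥1 j≤2n))
      (trans (+-comm vValue uValue) uValue+vValue) (vSum i≥1 i≤k)

  data Primary (ℓ : ℕ) : Set where
    viaU : ∀ i j → 1 ≤ i → i ≤ k → 1 ≤ j → j ≤ 2 * n → uLabel i j ≡ ℓ → Primary ℓ
    viaV : ∀ i j → 1 ≤ i → i ≤ k → 1 ≤ j → j ≤ 2 * n → vLabel i j ≡ ℓ → Primary ℓ

  data Attained (ℓ : ℕ) : Set where
    viaMatching : ∀ {i} → 1 ≤ i → i ≤ 2 * k → matchingLabel i ≡ ℓ → Attained ℓ
    viaPrimary : Primary ℓ → Attained ℓ
    viaComplement : ∀ {ℓ′} → Primary ℓ′ → C ∸ ℓ′ ≡ ℓ → Attained ℓ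

  private
    uTail-skip : ∀ i l l′ x → uTail i l (l′ * 2 + x) ≡ uTail i (l + l′) x
    uTail-skip i l zero x = cong (λ l → uTail i l x) (sym (+-identityʳ l))
    uTail-skip i l (suc l′) x = trans (uTail-skip i (suc l) l′ x) (cong (λ l → uTail i l x) (sym (+-suc l l′)))

    vTail-skip : ∀ i l l′ x → vTail i l (l′ * 2 + x) ≡ vTail i (l + l′) x
    vTail-skip i l zero x = cong (λ l → vTail i l x) (sym (+-identityʳ l))
    vTail-skip i l (suc l′) x = trans (vTail-skip i (suc l) l′ x) (cong (λ l → vTail i l x) (sym (+-suc l l′)))

    a+c≡b⇒a≡b∸c : ∀ a b c → a + c ≡ b → a ≡ b ∸ c
    a+c≡b⇒a≡b∸c a b c refl = sym (m+n∸n≡m a c)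

    ∸-< : ∀ t a b → a ≤ t → t < a + b → t ∸ a < b
    ∸-< t a b a≤t t<a+b = +-cancelˡ-< a _ _ (subst (_< a + b) (sym (m+[n∸m]≡n a≤t)) t<a+b)

    1≤2n : 1 ≤ 2 * n
    1≤2n = s≤s z≤n

    2≤2n : 2 ≤ 2 * n
    2≤2n = *-monoʳ-≤ 2 (s≤s z≤n)

  -- Each t ∈ [1, T] gives P + t or 1 + P − t as a value of uLabel or vLabel; the four
  -- ranges t ≤ k, t ≤ 3k, t ≤ 4k, t ≤ T correspond to the columns j = 1, j ∈ {1, 2}, j = 2, j ≥ 3.
  primary-around-P : ∀ t → 1 ≤ t → t ≤ T → Primary (P + t) ⊎ Primary (suc P ∸ t)
  primary-around-P t t≥1 t≤T with t ≤? k
  ... | yes t≤k = inj₂ (viaV (suc k ∸ t) 1 (m<n⇒0<n∸m (s≤s t≤k)) (m≤n+o⇒m∸n≤o (suc k) t (+-monoˡ-≤ k t≥1)) ≤-refl 1≤2n eq)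
    where
    eq : P ∸ k + (suc k ∸ t) ≡ suc P ∸ t
    eq = a+c≡b⇒a≡b∸c _ _ _ (trans (+-assoc (P ∸ k) (suc k ∸ t) t) (trans (cong (P ∸ k +_) (m∸n+n≡m (≤-trans t≤k (n≤1+n k))))
           (trans (+-suc (P ∸ k) k) (cong suc (m∸n+n≡m k≤P)))))
  ... | no t≰k with t ≤? 3 * k
  ...   | yes t≤3k = columns12 (divMod (t ∸ suc k) 2 k (∸-< t (suc k) (k * 2) (≰⇒> t≰k) (s≤s (≤-trans t≤3k (≤-reflexive (sym (k+2k≡3k k)))))))
    where
    t≡ : t ≡ suc k + (t ∸ suc k)
    t≡ = sym (m+[n∸m]≡n (≰⇒> t≰k))
    columns12 : (Σ ℕ λ q → Σ ℕ λ ρ → (q < k) × (ρ < 2) × (t ∸ suc k ≡ q * 2 + ρ)) → Primary (P + t) ⊎ Primary (suc P ∸ t)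
    columns12 (q , zero , q<k , _ , t∸≡) = inj₂ (viaU (suc q) 1 (s≤s z≤n) q<k ≤-refl 1≤2n eq)
      where
      a = uLabel (suc q) 1
      eq : a ≡ suc P ∸ t
      eq = a+c≡b⇒a≡b∸c _ _ _ (suc-injective (trans (cong (λ t → suc (a + t)) (trans t≡ (cong (suc k +_) (trans t∸≡ (+-identityʳ _)))))
             (trans (uLabel₁-cover-id a q k) (trans (cong (_+ k) (m∸n+n≡m (≤-trans (m≤n+m _ (suc (2 * k))) (1+2k+2i≤k+T+2 (s≤s z≤n) q<k))))
               (1+P+1-id k n′)))))
    columns12 (q , suc zero , q<k , _ , t∸≡) = inj₂ (viaV (suc q) 2 (s≤s z≤n) q<k (s≤s z≤n) 2≤2n
      (cong (suc P ∸_) (trans (vLabel₂-cover-id q k) (trans (cong (suc k +_) (sym t∸≡)) (sym t≡)))))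
    columns12 (q , suc (suc ρ) , _ , s≤s (s≤s ()) , _)
  ...   | no t≰3k with t ≤? 4 * k
  ...     | yes t≤4k = inj₁ (viaU (t ∸ 3 * k) 2 (m<n⇒0<n∸m (≰⇒> t≰3k)) (m≤n+o⇒m∸n≤o t (3 * k) (≤-trans t≤4k (≤-reflexive (sym (3k+k≡4k k))))) (s≤s z≤n) 2≤2n
      (trans (+-assoc P (3 * k) (t ∸ 3 * k)) (cong (P +_) (m+[n∸m]≡n (<⇒≤ (≰⇒> t≰3k))))))
  ...     | no t≰4k = tailColumns (divMod (t ∸ suc (4 * k)) 4 (k * n′)
              (∸-< t (suc (4 * k)) (k * n′ * 4) (≰⇒> t≰4k) (s≤s (≤-trans t≤T (≤-reflexive (T≡4k+4kn′ k n′))))))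
    where
    t≡ : t ≡ suc (4 * k) + (t ∸ suc (4 * k))
    t≡ = sym (m+[n∸m]≡n (≰⇒> t≰4k))
    tailColumns : (Σ ℕ λ w → Σ ℕ λ ρ → (w < k * n′) × (ρ < 4) × (t ∸ suc (4 * k) ≡ w * 4 + ρ)) → Primary (P + t) ⊎ Primary (suc P ∸ t)
    tailColumns (w , ρ , w< , ρ<4 , t∸≡) with divMod w k {{k≢0}} n′ (subst (w <_) (*-comm k n′) w<)
      where
      k≢0 : NonZero k
      k≢0 = m*n≢0⇒m≢0 k {{>-nonZero (≤-<-trans z≤n w<)}}
    ... | l′ , i′ , l′<n′ , i′<k , w≡ = byResidue ρ ρ<4 t≡1+ρ+b
      where
      b = offset (suc l′) (suc i′)
      t≡1+ρ+b : t ≡ suc ρ + b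
      t≡1+ρ+b = trans t≡ (trans (cong (suc (4 * k) +_) (trans t∸≡ (cong (λ w → w * 4 + ρ) w≡))) (tail-cover-id k l′ i′ ρ))
      odd≤2n : 3 + (l′ * 2 + 1) ≤ 2 * n
      odd≤2n = subst (_≤ 2 * n) (sym (tail-index-id l′)) (*-monoʳ-≤ 2 (s≤s l′<n′))
      even≤2n : 3 + (l′ * 2 + 0) ≤ 2 * n
      even≤2n = ≤-trans (+-monoʳ-≤ 3 (+-monoʳ-≤ (l′ * 2) z≤n)) odd≤2n
      byResidue : ∀ ρ → ρ < 4 → t ≡ suc ρ + b → Primary (P + t) ⊎ Primary (suc P ∸ t)
      byResidue zero _ t≡′ = inj₂ (viaU (suc i′) (3 + (l′ * 2 + 1)) (s≤s z≤n) i′<k (s≤s z≤n) odd≤2n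
        (trans (uTail-skip (suc i′) 1 l′ 1) (cong (suc P ∸_) (sym t≡′))))
      byResidue (suc zero) _ t≡′ = inj₁ (viaU (suc i′) (3 + (l′ * 2 + 0)) (s≤s z≤n) i′<k (s≤s z≤n) even≤2n
        (trans (uTail-skip (suc i′) 1 l′ 0) (trans (+-assoc P b 2) (cong (P +_) (trans (+-comm b 2) (sym t≡′))))))
      byResidue (suc (suc zero)) _ t≡′ = inj₁ (viaV (suc i′) (3 + (l′ * 2 + 0)) (s≤s z≤n) i′<k (s≤s z≤n) even≤2n
        (trans (vTail-skip (suc i′) 1 l′ 0) (trans (+-assoc P b 3) (cong (P +_) (trans (+-comm b 3) (sym t≡′))))))
      byResidue (suc (suc (suc zero))) _ t≡′ = inj₂ (viaV (suc i′) (3 + (l′ * 2 + 1)) (s≤s z≤n) i′<k (s≤s z≤n) odd≤2n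
        (trans (vTail-skip (suc i′) 1 l′ 1) (trans (cong (P ∸_) (+-comm b 3)) (cong (suc P ∸_) (sym t≡′)))))
      byResidue (suc (suc (suc (suc ρ)))) (s≤s (s≤s (s≤s (s≤s ())))) _

  attained : ∀ ℓ → 1 ≤ ℓ → ℓ ≤ Q → Attained ℓ
  attained ℓ ℓ≥1 ℓ≤Q with ℓ ≤? 2 * k
  ... | yes ℓ≤2k with ℓ ≤? k
  ...   | yes ℓ≤k = viaMatching (≤-trans ℓ≥1 (m≤n+m ℓ k)) (≤-trans (+-monoʳ-≤ k ℓ≤k) (≤-reflexive (cong (k +_) (sym (+-identityʳ k)))))
      (trans (matchingLabel-high (λ k+ℓ≤k → <-irrefl refl (<-≤-trans (subst (_< k + ℓ) (+-identityʳ k) (+-monoʳ-< k ℓ≥1)) k+ℓ≤k)))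
        (m+n∸m≡n k ℓ))
  ...   | no ℓ≰k = viaMatching (m<n⇒0<n∸m (≰⇒> ℓ≰k)) (≤-trans (m∸n≤m ℓ k) ℓ≤2k)
      (trans (matchingLabel-low (m≤n+o⇒m∸n≤o ℓ k (≤-trans ℓ≤2k (≤-reflexive (cong (k +_) (+-identityʳ k)))))) (m+[n∸m]≡n (<⇒≤ (≰⇒> ℓ≰k))))
  attained ℓ ℓ≥1 ℓ≤Q | no ℓ≰2k with ℓ ≤? P
  ...   | yes ℓ≤P = fromBelow (primary-around-P t (m<n⇒0<n∸m (s≤s ℓ≤P)) (m≤n+o⇒m∸n≤o (suc P) ℓ (+-monoˡ-≤ T (≰⇒> ℓ≰2k))))
    where
    t = suc P ∸ ℓ
    back : suc P ∸ t ≡ ℓ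
    back = m∸[m∸n]≡n (≤-trans ℓ≤P (n≤1+n P))
    C≡ : C ≡ (P + t) + ℓ
    C≡ = trans (sym (+-suc P P)) (trans (cong (P +_) (sym (trans (+-comm t ℓ) (m+[n∸m]≡n (≤-trans ℓ≤P (n≤1+n P)))))) (sym (+-assoc P t ℓ)))
    fromBelow : Primary (P + t) ⊎ Primary (suc P ∸ t) → Attained ℓ
    fromBelow (inj₁ p) = viaComplement p (trans (cong (_∸ (P + t)) C≡) (m+n∸m≡n (P + t) ℓ))
    fromBelow (inj₂ p) = viaPrimary (subst Primary back p)
  ...   | no ℓ≰P = fromAbove (primary-around-P t (m<n⇒0<n∸m (≰⇒> ℓ≰P)) (m≤n+o⇒m∸n≤o ℓ P ℓ≤Q))
    where
    t = ℓ ∸ P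
    back : P + t ≡ ℓ
    back = m+[n∸m]≡n (<⇒≤ (≰⇒> ℓ≰P))
    t≤1+P : t ≤ suc P
    t≤1+P = ≤-trans (m≤n+o⇒m∸n≤o ℓ P ℓ≤Q) (≤-trans (m≤n+m T (2 * k)) (n≤1+n P))
    C≡ : C ≡ (P + t) + (suc P ∸ t)
    C≡ = sym (trans (+-assoc P t _) (trans (cong (P +_) (m+[n∸m]≡n t≤1+P)) (+-suc P P)))
    fromAbove : Primary (P + t) ⊎ Primary (suc P ∸ t) → Attained ℓ
    fromAbove (inj₁ p) = viaPrimary (subst Primary back p)
    fromAbove (inj₂ p) = viaComplement p (trans (cong (_∸ (suc P ∸ t)) C≡) (trans (m+n∸n≡m (P + t) (suc P ∸ t)) back))

module FromEdgeLabels (E : List (V × V)) (ℓ : V × V → ℕ)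
  (ℓ-range : All (λ e → (1 ≤ ℓ e) × (ℓ e ≤ length E)) E)
  (ℓ-onto : ∀ m → 1 ≤ m → m ≤ length E → Σ (V × V) λ e → (e ∈ E) × (ℓ e ≡ m)) where

  private
    range-at : (e : Fin (length E)) → (1 ≤ ℓ (lookup E e)) × (ℓ (lookup E e) ≤ length E)
    range-at e = All.lookup ℓ-range (∈-lookup e)

    1+[x∸1]≡x : ∀ {x} → 1 ≤ x → suc (x ∸ 1) ≡ x
    1+[x∸1]≡x (s≤s z≤n) = refl

    pred< : (e : Fin (length E)) → ℓ (lookup E e) ∸ 1 < length E
    pred< e = subst (_≤ length E) (sym (1+[x∸1]≡x (proj₁ (range-at e)))) (proj₂ (range-at e))

    index : Fin (length E) → Fin (length E)
    index e = fromℕ< (pred< e)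

    label≡ℓ : ∀ e → suc (toℕ (index e)) ≡ ℓ (lookup E e)
    label≡ℓ e = trans (cong suc (toℕ-fromℕ< (pred< e))) (1+[x∸1]≡x (proj₁ (range-at e)))

    index-onto : StrictlySurjective _≡_ index
    index-onto m with ℓ-onto (suc (toℕ m)) (s≤s z≤n) (toℕ<n m)
    ... | e , e∈ , ℓe≡ = Any.index e∈ , toℕ-injective (suc-injective
      (trans (label≡ℓ (Any.index e∈)) (trans (cong ℓ (sym (lookup-index e∈))) ℓe≡)))

  labeling : Labeling E
  labeling = index , strictlySurjective⇒bijective index-onto

  fplus-labeling : ∀ w → fplus E labeling w ≡ ∑ E (λ e → incidence w e (ℓ e))
  fplus-labeling w = trans (cong sum (map-cong (λ e → cong (incidence w (lookup E e)) (label≡ℓ e)) (allFin (length E))))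
    (cong sum (trans (map-tabulate (λ e → e) (λ e → g (lookup E e)))
      (trans (sym (map-tabulate (lookup E) g)) (cong (map g) (tabulate-lookup E)))))
    where
    g : V × V → ℕ
    g e = incidence w e (ℓ e)

module Construction (n′ r s : ℕ) where

  open Graph (suc n′) r s public
  open Labels k n′ public

  private
    block-bounds : ∀ {b i} → 1 ≤ b → b ≤ r → suc ((b ∸ 1) * s) ≤ i → i ≤ b * s → (1 ≤ i) × (i ≤ k)
    block-bounds b≥1 b≤r i≥ i≤ = ≤-trans (s≤s z≤n) i≥ , ≤-trans i≤ (*-monoˡ-≤ s b≤r)

    2k≤Q : 2 * k ≤ Q
    2k≤Q = ≤-trans (m≤m+n (2 * k) T) (m≤m+n P T)

  InRange : V × V → Set
  InRange e = (1 ≤ lab e) × (lab e ≤ Q)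

  lab-range : All InRange E
  lab-range = All-edges InRange matching quads
    where
    High⇒InRange : ∀ {e} → High (lab e) → InRange e
    High⇒InRange (lo , hi) = ≤-trans (s≤s z≤n) lo , hi

    matching : ∀ i → 1 ≤ i → i ≤ 2 * k → InRange (u i , v i)
    matching i i≥1 i≤2k with i ≤? k
    ... | yes i≤k = subst (λ x → (1 ≤ x) × (x ≤ Q)) (sym (matchingLabel-low i≤k))
                      (≤-trans i≥1 (m≤n+m i k) , ≤-trans (+-monoʳ-≤ k i≤k) (≤-trans (≤-reflexive (cong (k +_) (sym (+-identityʳ k)))) 2k≤Q))
    ... | no i≰k = subst (λ x → (1 ≤ x) × (x ≤ Q)) (sym (matchingLabel-high i≰k))
                      (m<n⇒0<n∸m (≰⇒> i≰k) , ≤-trans (m∸n≤m i k) (≤-trans i≤2k 2k≤Q))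

    quads : ∀ b i j → 1 ≤ b → b ≤ r → suc ((b ∸ 1) * s) ≤ i → i ≤ b * s → 1 ≤ j → j ≤ 2 * n → All InRange (quad b i j)
    quads b i j b≥1 b≤r i≥ i≤ j≥1 j≤2n with block-bounds b≥1 b≤r i≥ i≤
    ... | i≥1 , i≤k =
      High⇒InRange {u i , y b j} (uLabel-high i≥1 i≤k j≥1 j≤2n) ∷
      High⇒InRange {v (mirror k i) , y b j} (subst High (cong (λ i → C ∸ uLabel i j) (sym (mirror-involutive {k} (≤2k i≤k))))
        (High-complement (uLabel-high i≥1 i≤k j≥1 j≤2n))) ∷
      High⇒InRange {v i , z b j} (vLabel-high i≥1 i≤k j≥1 j≤2n) ∷
      High⇒InRange {u (mirror k i) , z b j} (subst High (cong (λ i → C ∸ vLabel i j) (sym (mirror-involutive {k} (≤2k i≤k))))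
        (High-complement (vLabel-high i≥1 i≤k j≥1 j≤2n))) ∷ []

  length-E : length E ≡ Q
  length-E = begin
    length E                                                      ≡⟨ length≡∑1 E ⟩
    ∑ E (λ _ → 1)                                                 ≡⟨ ∑-edges (λ _ → 1) ⟩
    ∑ (fromTo 1 (2 * k)) (λ _ → 1) + ∑ (fromTo 1 r) (λ b → ∑ (block b) (λ _ → ∑ (fromTo 1 (2 * n)) (λ _ → 4)))
                                                                  ≡⟨ cong₂ _+_ (fromTo-∑-const (2 * k) 1) (trans (fromTo-∑-cong 1 r (λ b b≥1 _ → per-block b b≥1)) (fromTo-∑-const r _)) ⟩
    2 * k * 1 + r * (s * (2 * n * 4))                             ≡⟨ length-edges-id r s n′ ⟩
    Q                                                             ∎
    where
    open ≡-Reasoning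
    length≡∑1 : ∀ {A : Set} (xs : List A) → length xs ≡ ∑ xs (λ _ → 1)
    length≡∑1 [] = refl
    length≡∑1 (x ∷ xs) = cong suc (length≡∑1 xs)
    per-block : ∀ b → 1 ≤ b → ∑ (block b) (λ _ → ∑ (fromTo 1 (2 * n)) (λ _ → 4)) ≡ s * (2 * n * 4)
    per-block (suc b) _ = trans (cong (λ is → ∑ is (λ _ → ∑ (fromTo 1 (2 * n)) (λ _ → 4))) (block≡range b))
      (trans (∑-cong (range (suc (b * s)) s) (λ _ → fromTo-∑-const (2 * n) 4)) (range-∑-const (suc (b * s)) s (2 * n * 4)))

  lab-onto : ∀ m → 1 ≤ m → m ≤ length E → Σ (V × V) λ e → (e ∈ E) × (lab e ≡ m)
  lab-onto m m≥1 m≤ = fromAttained (attained m m≥1 (subst (m ≤_) length-E m≤))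
    where
    fromPrimary : ∀ {ℓ} → Primary ℓ → Σ (V × V) λ e → Σ (V × V) λ e′ → (e ∈ E) × (e′ ∈ E) × (lab e ≡ ℓ) × (lab e′ ≡ C ∸ ℓ)
    fromPrimary (viaU i j i≥1 i≤k j≥1 j≤2n refl) with block-of i i≥1 i≤k
    ... | b , b≥1 , b≤r , i≥ , i≤ = (u i , y b j) , (v (mirror k i) , y b j) ,
          quad⊆edges b i j b≥1 b≤r i≥ i≤ j≥1 j≤2n (here refl) , quad⊆edges b i j b≥1 b≤r i≥ i≤ j≥1 j≤2n (there (here refl)) ,
          refl , cong (λ i → C ∸ uLabel i j) (mirror-involutive {k} (≤2k i≤k))
    fromPrimary (viaV i j i≥1 i≤k j≥1 j≤2n refl) with block-of i i≥1 i≤k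
    ... | b , b≥1 , b≤r , i≥ , i≤ = (v i , z b j) , (u (mirror k i) , z b j) ,
          quad⊆edges b i j b≥1 b≤r i≥ i≤ j≥1 j≤2n (there (there (here refl))) , quad⊆edges b i j b≥1 b≤r i≥ i≤ j≥1 j≤2n (there (there (there (here refl)))) ,
          refl , cong (λ i → C ∸ vLabel i j) (mirror-involutive {k} (≤2k i≤k))

    fromAttained : Attained m → Σ (V × V) λ e → (e ∈ E) × (lab e ≡ m)
    fromAttained (viaMatching {i} i≥1 i≤2k eq) = (u i , v i) , matching∈edges i i≥1 i≤2k , eq
    fromAttained (viaPrimary p) with fromPrimary p
    ... | e , _ , e∈ , _ , eq , _ = e , e∈ , eq
    fromAttained (viaComplement p eq′) with fromPrimary p
    ... | _ , e′ , _ , e′∈ , _ , eq = e′ , e′∈ , trans eq eq′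

  open FromEdgeLabels E lab (All.map (λ {e} → subst (λ q → (1 ≤ lab e) × (lab e ≤ q)) (sym length-E)) lab-range) lab-onto public

  weight : V → V × V → ℕ
  weight w e = incidence w e (lab e)

  private
    column-value : ∀ w {i₀} → 1 ≤ i₀ → i₀ ≤ k →
      (∀ b i j → ∑ (quad b i j) (weight w) ≡ ∑ (quad 0 i j) (weight w)) →
      (∀ i → 1 ≤ i → i ≤ k → i ≢ i₀ → ∀ j → ∑ (quad 0 i j) (weight w) ≡ 0) →
      ∑ E (weight w) ≡ ∑ (fromTo 1 (2 * k)) (λ i → weight w (u i , v i)) + ∑ (fromTo 1 (2 * n)) (λ j → ∑ (quad 0 i₀ j) (weight w))
    column-value w {i₀} i₀≥1 i₀≤k b-free others = trans (∑-edges (weight w)) (cong (∑ (fromTo 1 (2 * k)) (λ i → weight w (u i , v i)) +_) (begin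
      ∑ (fromTo 1 r) (λ b → ∑ (block b) (λ i → ∑ (fromTo 1 (2 * n)) (λ j → ∑ (quad b i j) (weight w))))
        ≡⟨ ∑-cong (fromTo 1 r) (λ b → ∑-cong (block b) (λ i → ∑-cong (fromTo 1 (2 * n)) (λ j → b-free b i j))) ⟩
      ∑ (fromTo 1 r) (λ b → ∑ (block b) G)
        ≡⟨ ∑-blocks G ⟩
      ∑ (range 1 k) G
        ≡⟨ range-∑-single 1 k i₀ i₀≥1 (s≤s i₀≤k) (λ i i≥1 i<1+k i≢i₀ → ∑-≡0 (fromTo 1 (2 * n)) (others i i≥1 (s≤s⁻¹ i<1+k) i≢i₀)) ⟩
      G i₀ ∎))
      where
      open ≡-Reasoning
      G : ℕ → ℕ
      G i = ∑ (fromTo 1 (2 * n)) (λ j → ∑ (quad 0 i j) (weight w))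

    matching-value : ∀ w {i₀} → 1 ≤ i₀ → i₀ ≤ 2 * k → (∀ i → i ≢ i₀ → weight w (u i , v i) ≡ 0) →
      ∑ (fromTo 1 (2 * k)) (λ i → weight w (u i , v i)) ≡ weight w (u i₀ , v i₀)
    matching-value w {i₀} i₀≥1 i₀≤2k others = fromTo-∑-single 1 (2 * k) i₀ i₀≥1 i₀≤2k (λ i _ _ → others i)

    u≢u : ∀ {i i′} → i ≢ i′ → u i ≢ u i′
    u≢u i≢i′ eq = i≢i′ (u-inj eq)

    v≢v : ∀ {i i′} → i ≢ i′ → v i ≢ v i′
    v≢v i≢i′ eq = i≢i′ (v-inj eq)

  ∑-weight-u : ∀ {i₀} → 1 ≤ i₀ → i₀ ≤ k → ∑ E (weight (u i₀)) ≡ matchingLabel i₀ + ∑ (fromTo 1 (2 * n)) (uLabel i₀)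
  ∑-weight-u {i₀} i₀≥1 i₀≤k = trans (column-value (u i₀) i₀≥1 i₀≤k (λ _ _ _ → refl) others) (cong₂ _+_
    (trans (matching-value (u i₀) i₀≥1 (≤2k {k} i₀≤k) (λ i i≢i₀ → incidence-none (u i₀) (u i) (v i) (u≢u (≢-sym i≢i₀)) (λ ())))
      (incidence-fst (u i₀) (u i₀) (v i₀) refl))
    (fromTo-∑-cong 1 (2 * n) (λ j _ _ → trans (quad-value i₀ j i₀≤k) (incidence-fst (u i₀) (u i₀) (y 0 j) refl))))
    where
    quad-value : ∀ i j → i ≤ k → ∑ (quad 0 i j) (weight (u i₀)) ≡ incidence (u i₀) (u i , y 0 j) (uLabel i j)
    quad-value i j i≤k = trans
      (cong (λ d → incidence (u i₀) (u i , y 0 j) (uLabel i j) + (0 + (0 + (d + 0))))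
        (incidence-none (u i₀) (u (mirror k i)) (z 0 j) (u≢u (≢mirror {k} i≤k i₀≤k)) (λ ())))
      (+-identityʳ _)
    others : ∀ i → 1 ≤ i → i ≤ k → i ≢ i₀ → ∀ j → ∑ (quad 0 i j) (weight (u i₀)) ≡ 0
    others i _ i≤k i≢i₀ j = trans (quad-value i j i≤k) (incidence-none (u i₀) (u i) (y 0 j) (u≢u (≢-sym i≢i₀)) (λ ()))

  ∑-weight-v : ∀ {i₀} → 1 ≤ i₀ → i₀ ≤ k → ∑ E (weight (v i₀)) ≡ matchingLabel i₀ + ∑ (fromTo 1 (2 * n)) (vLabel i₀)
  ∑-weight-v {i₀} i₀≥1 i₀≤k = trans (column-value (v i₀) i₀≥1 i₀≤k (λ _ _ _ → refl) others) (cong₂ _+_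
    (trans (matching-value (v i₀) i₀≥1 (≤2k {k} i₀≤k) (λ i i≢i₀ → incidence-none (v i₀) (u i) (v i) (λ ()) (v≢v (≢-sym i≢i₀))))
      (incidence-snd (v i₀) (u i₀) (v i₀) (λ ()) refl))
    (fromTo-∑-cong 1 (2 * n) (λ j _ _ → trans (quad-value i₀ j i₀≤k) (incidence-fst (v i₀) (v i₀) (z 0 j) refl))))
    where
    quad-value : ∀ i j → i ≤ k → ∑ (quad 0 i j) (weight (v i₀)) ≡ incidence (v i₀) (v i , z 0 j) (vLabel i j)
    quad-value i j i≤k = trans
      (cong (λ b → 0 + (b + (incidence (v i₀) (v i , z 0 j) (vLabel i j) + (0 + 0))))
        (incidence-none (v i₀) (v (mirror k i)) (y 0 j) (v≢v (≢mirror {k} i≤k i₀≤k)) (λ ())))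
      (+-identityʳ _)
    others : ∀ i → 1 ≤ i → i ≤ k → i ≢ i₀ → ∀ j → ∑ (quad 0 i j) (weight (v i₀)) ≡ 0
    others i _ i≤k i≢i₀ j = trans (quad-value i j i≤k) (incidence-none (v i₀) (v i) (z 0 j) (v≢v (≢-sym i≢i₀)) (λ ()))

  ∑-weight-mirror-v : ∀ {i₀} → 1 ≤ i₀ → i₀ ≤ k →
    ∑ E (weight (v (mirror k i₀))) ≡ matchingLabel (mirror k i₀) + ∑ (fromTo 1 (2 * n)) (λ j → C ∸ uLabel i₀ j)
  ∑-weight-mirror-v {i₀} i₀≥1 i₀≤k = trans (column-value w i₀≥1 i₀≤k (λ _ _ _ → refl) others) (cong₂ _+_
    (trans (matching-value w (mirror≥1 i₀≤k) (mirror≤2k {k} i₀≥1) (λ i i≢ → incidence-none w (u i) (v i) (λ ()) (v≢v (≢-sym i≢))))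
      (incidence-snd w (u i₀′) w (λ ()) refl))
    (fromTo-∑-cong 1 (2 * n) (λ j _ _ → trans (quad-value i₀ j i₀≤k)
      (trans (incidence-fst w w (y 0 j) refl) (cong (λ i → C ∸ uLabel i j) (mirror-involutive {k} (≤2k {k} i₀≤k)))))))
    where
    i₀′ = mirror k i₀
    w = v i₀′
    quad-value : ∀ i j → i ≤ k → ∑ (quad 0 i j) (weight w) ≡ incidence w (v (mirror k i) , y 0 j) (C ∸ uLabel (mirror k (mirror k i)) j)
    quad-value i j i≤k = trans
      (cong (λ c → 0 + (incidence w (v (mirror k i) , y 0 j) (C ∸ uLabel (mirror k (mirror k i)) j) + (c + (0 + 0))))
        (incidence-none w (v i) (z 0 j) (v≢v (≢-sym (≢mirror {k} i₀≤k i≤k))) (λ ())))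
      (+-identityʳ _)
    others : ∀ i → 1 ≤ i → i ≤ k → i ≢ i₀ → ∀ j → ∑ (quad 0 i j) (weight w) ≡ 0
    others i _ i≤k i≢i₀ j = trans (quad-value i j i≤k) (incidence-none w (v (mirror k i)) (y 0 j)
      (v≢v (λ eq → i≢i₀ (sym (mirror-injective {k} (≤2k {k} i₀≤k) (≤2k {k} i≤k) eq)))) (λ ()))

  ∑-weight-mirror-u : ∀ {i₀} → 1 ≤ i₀ → i₀ ≤ k →
    ∑ E (weight (u (mirror k i₀))) ≡ matchingLabel (mirror k i₀) + ∑ (fromTo 1 (2 * n)) (λ j → C ∸ vLabel i₀ j)
  ∑-weight-mirror-u {i₀} i₀≥1 i₀≤k = trans (column-value w i₀≥1 i₀≤k (λ _ _ _ → refl) others) (cong₂ _+_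
    (trans (matching-value w (mirror≥1 i₀≤k) (mirror≤2k {k} i₀≥1) (λ i i≢ → incidence-none w (u i) (v i) (u≢u (≢-sym i≢)) (λ ())))
      (incidence-fst w w (v i₀′) refl))
    (fromTo-∑-cong 1 (2 * n) (λ j _ _ → trans (quad-value i₀ j i₀≤k)
      (trans (incidence-fst w w (z 0 j) refl) (cong (λ i → C ∸ vLabel i j) (mirror-involutive {k} (≤2k {k} i₀≤k)))))))
    where
    i₀′ = mirror k i₀
    w = u i₀′
    quad-value : ∀ i j → i ≤ k → ∑ (quad 0 i j) (weight w) ≡ incidence w (u (mirror k i) , z 0 j) (C ∸ vLabel (mirror k (mirror k i)) j)
    quad-value i j i≤k = trans
      (cong (λ a → a + (0 + (0 + (incidence w (u (mirror k i) , z 0 j) (C ∸ vLabel (mirror k (mirror k i)) j) + 0))))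
        (incidence-none w (u i) (y 0 j) (u≢u (≢-sym (≢mirror {k} i₀≤k i≤k))) (λ ())))
      (+-identityʳ _)
    others : ∀ i → 1 ≤ i → i ≤ k → i ≢ i₀ → ∀ j → ∑ (quad 0 i j) (weight w) ≡ 0
    others i _ i≤k i≢i₀ j = trans (quad-value i j i≤k) (incidence-none w (u (mirror k i)) (z 0 j)
      (u≢u (λ eq → i≢i₀ (sym (mirror-injective {k} (≤2k {k} i₀≤k) (≤2k {k} i≤k) eq)))) (λ ()))

  ∑-weight-y : ∀ {b₀ j₀} → 1 ≤ b₀ → b₀ ≤ r → 1 ≤ j₀ → j₀ ≤ 2 * n →
    ∑ E (weight (y b₀ j₀)) ≡ ∑ (block b₀) (λ i → uLabel i j₀ + (C ∸ uLabel i j₀))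
  ∑-weight-y {b₀} {j₀} b₀≥1 b₀≤r j₀≥1 j₀≤2n = trans (∑-edges (weight w)) (cong₂ _+_
    (∑-≡0 (fromTo 1 (2 * k)) (λ _ → refl))
    (trans (fromTo-∑-single 1 r b₀ b₀≥1 b₀≤r (λ b _ _ b≢b₀ → ∑-≡0 (block b) (λ i → ∑-≡0 (fromTo 1 (2 * n)) (λ j →
              trans (quad-value b i j) (cong₂ _+_ (incidence-none w (u i) (y b j) (λ ()) (λ eq → b≢b₀ (sym (proj₁ (y-inj eq)))))
                                                   (incidence-none w (v (mirror k i)) (y b j) (λ ()) (λ eq → b≢b₀ (sym (proj₁ (y-inj eq))))))))))
      (fromTo-∑-cong _ _ (λ i i≥ i≤ → trans
        (fromTo-∑-single 1 (2 * n) j₀ j₀≥1 j₀≤2n (λ j _ _ j≢j₀ →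
          trans (quad-value b₀ i j) (cong₂ _+_ (incidence-none w (u i) (y b₀ j) (λ ()) (λ eq → j≢j₀ (sym (proj₂ (y-inj eq)))))
                                                (incidence-none w (v (mirror k i)) (y b₀ j) (λ ()) (λ eq → j≢j₀ (sym (proj₂ (y-inj eq))))))))
        (trans (quad-value b₀ i j₀) (cong₂ _+_ (incidence-snd w (u i) w (λ ()) refl)
          (trans (incidence-snd w (v (mirror k i)) w (λ ()) refl)
            (cong (λ i → C ∸ uLabel i j₀) (mirror-involutive {k} (≤2k {k} (proj₂ (block-bounds b₀≥1 b₀≤r i≥ i≤))))))))))))
    where
    w = y b₀ j₀
    quad-value : ∀ b i j → ∑ (quad b i j) (weight w) ≡
      incidence w (u i , y b j) (uLabel i j) + incidence w (v (mirror k i) , y b j) (C ∸ uLabel (mirror k (mirror k i)) j)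
    quad-value b i j = cong (incidence w (u i , y b j) (uLabel i j) +_) (+-identityʳ _)

  ∑-weight-z : ∀ {b₀ j₀} → 1 ≤ b₀ → b₀ ≤ r → 1 ≤ j₀ → j₀ ≤ 2 * n →
    ∑ E (weight (z b₀ j₀)) ≡ ∑ (block b₀) (λ i → vLabel i j₀ + (C ∸ vLabel i j₀))
  ∑-weight-z {b₀} {j₀} b₀≥1 b₀≤r j₀≥1 j₀≤2n = trans (∑-edges (weight w)) (cong₂ _+_
    (∑-≡0 (fromTo 1 (2 * k)) (λ _ → refl))
    (trans (fromTo-∑-single 1 r b₀ b₀≥1 b₀≤r (λ b _ _ b≢b₀ → ∑-≡0 (block b) (λ i → ∑-≡0 (fromTo 1 (2 * n)) (λ j →
              trans (quad-value b i j) (cong₂ _+_ (incidence-none w (v i) (z b j) (λ ()) (λ eq → b≢b₀ (sym (proj₁ (z-inj eq)))))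
                                                   (incidence-none w (u (mirror k i)) (z b j) (λ ()) (λ eq → b≢b₀ (sym (proj₁ (z-inj eq))))))))))
      (fromTo-∑-cong _ _ (λ i i≥ i≤ → trans
        (fromTo-∑-single 1 (2 * n) j₀ j₀≥1 j₀≤2n (λ j _ _ j≢j₀ →
          trans (quad-value b₀ i j) (cong₂ _+_ (incidence-none w (v i) (z b₀ j) (λ ()) (λ eq → j≢j₀ (sym (proj₂ (z-inj eq)))))
                                                (incidence-none w (u (mirror k i)) (z b₀ j) (λ ()) (λ eq → j≢j₀ (sym (proj₂ (z-inj eq))))))))
        (trans (quad-value b₀ i j₀) (cong₂ _+_ (incidence-snd w (v i) w (λ ()) refl)
          (trans (incidence-snd w (u (mirror k i)) w (λ ()) refl)
            (cong (λ i → C ∸ vLabel i j₀) (mirror-involutive {k} (≤2k {k} (proj₂ (block-bounds b₀≥1 b₀≤r i≥ i≤))))))))))))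
    where
    w = z b₀ j₀
    quad-value : ∀ b i j → ∑ (quad b i j) (weight w) ≡
      incidence w (v i , z b j) (vLabel i j) + incidence w (u (mirror k i) , z b j) (C ∸ vLabel (mirror k (mirror k i)) j)
    quad-value b i j = cong (incidence w (v i , z b j) (vLabel i j) +_) (+-identityʳ _)

  module _ (k≥1 : 1 ≤ k) where

    private
      mirror-bounds : ∀ {w} → ¬ w ≤ k → w ≤ 2 * k → (1 ≤ mirror k w) × (mirror k w ≤ k)
      mirror-bounds w≰k w≤2k = m<n⇒0<n∸m (s≤s w≤2k) , mirror-upper (≰⇒> w≰k) w≤2k

    u-value : ∀ {w} → 1 ≤ w → w ≤ 2 * k → ∑ E (weight (u w)) ≡ uValue
    u-value {w} w≥1 w≤2k with w ≤? k
    ... | yes w≤k = trans (∑-weight-u w≥1 w≤k) (uSum w≥1 w≤k)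
    ... | no w≰k with mirror-bounds w≰k w≤2k
    ...   | i≥1 , i≤k = subst (λ t → ∑ E (weight (u t)) ≡ uValue) (mirror-involutive {k} w≤2k)
                          (trans (∑-weight-mirror-u i≥1 i≤k) (mirror-vSum k≥1 i≥1 i≤k))

    v-value : ∀ {w} → 1 ≤ w → w ≤ 2 * k → ∑ E (weight (v w)) ≡ vValue
    v-value {w} w≥1 w≤2k with w ≤? k
    ... | yes w≤k = trans (∑-weight-v w≥1 w≤k) (vSum w≥1 w≤k)
    ... | no w≰k with mirror-bounds w≰k w≤2k
    ...   | i≥1 , i≤k = subst (λ t → ∑ E (weight (v t)) ≡ vValue) (mirror-involutive {k} w≤2k)
                          (trans (∑-weight-mirror-v i≥1 i≤k) (mirror-uSum k≥1 i≥1 i≤k))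

    ∑-block-pairs : (g : ℕ → ℕ) → (∀ i → 1 ≤ i → i ≤ k → g i ≤ C) → ∀ {b} → 1 ≤ b → b ≤ r →
      ∑ (block b) (λ i → g i + (C ∸ g i)) ≡ s * C
    ∑-block-pairs g g≤C {suc b} _ b≤r = trans (cong (λ is → ∑ is (λ i → g i + (C ∸ g i))) (block≡range b))
      (trans (∑-cong-All (All-range (suc (b * s)) s (λ i i≥ i< → m+[n∸m]≡n (g≤C i (≤-trans (s≤s z≤n) i≥)
               (≤-trans (s≤s⁻¹ (subst (i <_) (cong suc (+-comm (b * s) s)) i<)) (*-monoˡ-≤ s b≤r))))))
        (range-∑-const (suc (b * s)) s C))

    y-value : ∀ {b j} → 1 ≤ b → b ≤ r → 1 ≤ j → j ≤ 2 * n → ∑ E (weight (y b j)) ≡ s * C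
    y-value b≥1 b≤r j≥1 j≤2n = trans (∑-weight-y b≥1 b≤r j≥1 j≤2n)
      (∑-block-pairs _ (λ i i≥1 i≤k → High⇒≤C (uLabel-high i≥1 i≤k j≥1 j≤2n)) b≥1 b≤r)

    z-value : ∀ {b j} → 1 ≤ b → b ≤ r → 1 ≤ j → j ≤ 2 * n → ∑ E (weight (z b j)) ≡ s * C
    z-value b≥1 b≤r j≥1 j≤2n = trans (∑-weight-z b≥1 b≤r j≥1 j≤2n)
      (∑-block-pairs _ (λ i i≥1 i≤k → High⇒≤C (vLabel-high i≥1 i≤k j≥1 j≤2n)) b≥1 b≤r)

    labeling-localAntimagic : LocalAntimagic E labeling
    labeling-localAntimagic e eq = All.lookup distinct-ends (∈-lookup e)
      (trans (sym (fplus-labeling (proj₁ (lookup E e)))) (trans eq (fplus-labeling (proj₂ (lookup E e)))))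
      where
      DistinctEnds : V × V → Set
      DistinctEnds (a , b) = ∑ E (weight a) ≢ ∑ E (weight b)
      distinct-ends : All DistinctEnds E
      distinct-ends = All-edges DistinctEnds
        (λ i i≥1 i≤2k eq → uValue≢vValue k≥1 (trans (sym (u-value i≥1 i≤2k)) (trans eq (v-value i≥1 i≤2k))))
        (λ b i j b≥1 b≤r i≥ i≤ j≥1 j≤2n → let i≥1 , i≤k = block-bounds b≥1 b≤r i≥ i≤ in
          (λ eq → uValue≢multiple k≥1 s (trans (sym (u-value i≥1 (≤2k {k} i≤k))) (trans eq (y-value b≥1 b≤r j≥1 j≤2n)))) ∷
          (λ eq → vValue≢multiple k≥1 s (trans (sym (v-value (mirror≥1 i≤k) (mirror≤2k {k} i≥1))) (trans eq (y-value b≥1 b≤r j≥1 j≤2n)))) ∷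
          (λ eq → vValue≢multiple k≥1 s (trans (sym (v-value i≥1 (≤2k {k} i≤k))) (trans eq (z-value b≥1 b≤r j≥1 j≤2n)))) ∷
          (λ eq → uValue≢multiple k≥1 s (trans (sym (u-value (mirror≥1 i≤k) (mirror≤2k {k} i≥1))) (trans eq (z-value b≥1 b≤r j≥1 j≤2n)))) ∷ [])

    labeling-values : All (λ x → x ≡ uValue ⊎ x ≡ vValue ⊎ x ≡ s * C) (map (fplus E labeling) Vs)
    labeling-values = All.map⁺ (All-vertices (λ w → OneOf (fplus E labeling w))
      (λ i i≥1 i≤2k → inj₁ (value {u} i≥1 i≤2k u-value))
      (λ i i≥1 i≤2k → inj₂ (inj₁ (value {v} i≥1 i≤2k v-value)))
      (λ b j b≥1 b≤r j≥1 j≤2n → inj₂ (inj₂ (trans (fplus-labeling (y b j)) (y-value b≥1 b≤r j≥1 j≤2n))) ,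
                                inj₂ (inj₂ (trans (fplus-labeling (z b j)) (z-value b≥1 b≤r j≥1 j≤2n)))))
      where
      OneOf : ℕ → Set
      OneOf x = x ≡ uValue ⊎ x ≡ vValue ⊎ x ≡ s * C
      value : ∀ {c : ℕ → V} {i x} → 1 ≤ i → i ≤ 2 * k → (∀ {w} → 1 ≤ w → w ≤ 2 * k → ∑ E (weight (c w)) ≡ x) → fplus E labeling (c i) ≡ x
      value {c} {i} i≥1 i≤2k val = trans (fplus-labeling (c i)) (val i≥1 i≤2k)

    labeling-numColors : 1 ≤ r → numColors E Vs labeling ≡ 3
    labeling-numColors r≥1 = ≤-antisym (length-deduplicate≤3 _ uValue vValue (s * C) labeling-values)
      (length-deduplicate≥3 _ (has (u∈Vs 1 ≤-refl 1≤2k) (trans (fplus-labeling (u 1)) (u-value ≤-refl 1≤2k)))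
                              (has (v∈Vs 1 ≤-refl 1≤2k) (trans (fplus-labeling (v 1)) (v-value ≤-refl 1≤2k)))
                              (has (y∈Vs 1 1 ≤-refl r≥1 ≤-refl (s≤s z≤n)) (trans (fplus-labeling (y 1 1)) (y-value ≤-refl r≥1 ≤-refl (s≤s z≤n))))
                              (uValue≢vValue k≥1) (uValue≢multiple k≥1 s) (vValue≢multiple k≥1 s))
      where
      1≤2k : 1 ≤ 2 * k
      1≤2k = ≤2k {k} k≥1
      has : ∀ {w x} → w ∈ Vs → fplus E labeling w ≡ x → x ∈ map (fplus E labeling) Vs
      has {w} w∈ eq = subst (_∈ map (fplus E labeling) Vs) eq (∈-map⁺ (fplus E labeling) w∈)

endpointsIn : List V → V × V → ℕ
endpointsIn W e = ∑ W (λ w → incidence w e 1)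

∑-fplus : ∀ (E : List (V × V)) (f : Labeling E) (W : List V) →
  ∑ W (fplus E f) ≡ ∑ (allFin (length E)) (λ e → endpointsIn W (lookup E e) * label E f e)
∑-fplus E f W = trans (∑-swap W (allFin (length E)) (λ w e → incidence w (lookup E e) (label E f e)))
  (∑-cong (allFin (length E)) (λ e → trans (∑-cong W (λ w → incidence-scale w (lookup E e) (label E f e)))
    (∑-*ʳ W (λ w → incidence w (lookup E e) 1) (label E f e))))

double-counting : ∀ (E : List (V × V)) (f : Labeling E) (A B : List V) →
  All (λ e → endpointsIn A e ≡ endpointsIn B e) E → ∑ A (fplus E f) ≡ ∑ B (fplus E f)
double-counting E f A B balanced = trans (∑-fplus E f A)
  (trans (∑-cong (allFin (length E)) (λ e → cong (_* label E f e) (All.lookup balanced (∈-lookup e)))) (sym (∑-fplus E f B)))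

indicator : Bool → ℕ
indicator b = if b then 1 else 0

occurrences : List V → V → ℕ
occurrences W t = ∑ W (λ w → indicator (does (w ≟V t)))

endpointsIn-split : ∀ W a b → a ≢ b → endpointsIn W (a , b) ≡ occurrences W a + occurrences W b
endpointsIn-split W a b a≢b = trans (∑-cong W split) (∑-+ W _ _)
  where
  split : ∀ w → incidence w (a , b) 1 ≡ indicator (does (w ≟V a)) + indicator (does (w ≟V b))
  split w with w ≟V a | w ≟V b
  ... | yes refl | yes refl = ⊥-elim (a≢b refl)
  ... | yes _ | no _ = refl
  ... | no _ | yes _ = refl
  ... | no _ | no _ = refl

∑-map³ : ∀ {A : Set} (h : V → ℕ) (g₁ g₂ g₃ : A → V) xs₁ xs₂ xs₃ →
  ∑ (map g₁ xs₁ ++ map g₂ xs₂ ++ map g₃ xs₃) h ≡ ∑ xs₁ (h ∘ g₁) + (∑ xs₂ (h ∘ g₂) + ∑ xs₃ (h ∘ g₃))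
∑-map³ h g₁ g₂ g₃ xs₁ xs₂ xs₃ = trans (∑-++ (map g₁ xs₁) _ h) (cong₂ _+_ (∑-map g₁ xs₁ h)
  (trans (∑-++ (map g₂ xs₂) _ h) (cong₂ _+_ (∑-map g₂ xs₂ h) (∑-map g₃ xs₃ h))))

occurrences-none : ∀ (g : ℕ → V) {t} a c → (∀ i → a ≤ i → i ≤ c → g i ≢ t) → ∑ (fromTo a c) (λ i → indicator (does (g i ≟V t))) ≡ 0
occurrences-none g {t} a c g≢t = fromTo-∑-≡0 a c (λ i a≤i i≤c → cong indicator (dec-false (g i ≟V t) (g≢t i a≤i i≤c)))

occurrences-within : ∀ (g : ℕ → V) {i₀} a c → a ≤ i₀ → (∀ i → a ≤ i → i ≤ c → g i ≡ g i₀ → i ≡ i₀) →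
  ∑ (fromTo a c) (λ i → indicator (does (g i ≟V g i₀))) ≡ indicator (does (i₀ ≤? c))
occurrences-within g {i₀} a c a≤i₀ g-inj with i₀ ≤? c
... | yes i₀≤c = trans (fromTo-∑-single a c i₀ a≤i₀ i₀≤c (λ i a≤i i≤c i≢i₀ →
        cong indicator (dec-false (g i ≟V g i₀) (λ eq → i≢i₀ (g-inj i a≤i i≤c eq)))))
      (trans (cong indicator (dec-true (g i₀ ≟V g i₀) refl)) (sym (cong indicator (dec-true (i₀ ≤? c) i₀≤c))))
... | no i₀≰c = trans (occurrences-none g a c (λ i a≤i i≤c eq → i₀≰c (subst (_≤ c) (g-inj i a≤i i≤c eq) i≤c)))
      (sym (cong indicator (dec-false (i₀ ≤? c) i₀≰c)))

module Component (n′ r s : ℕ) (r≥1 : 1 ≤ r) (s≥1 : 1 ≤ s) where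

  open Graph (suc n′) r s

  private
    n : ℕ
    n = suc n′

    s≤k : s ≤ k
    s≤k = ≤-trans (≤-reflexive (sym (+-identityʳ s))) (*-monoˡ-≤ s r≥1)

  sideA : List V
  sideA = map u (fromTo 1 s) ++ map (λ i → v (mirror k i)) (fromTo 1 s) ++ map (z 1) (fromTo 1 (2 * n))

  sideB : List V
  sideB = map v (fromTo 1 s) ++ map (λ i → u (mirror k i)) (fromTo 1 s) ++ map (y 1) (fromTo 1 (2 * n))

  private
    ∑0 : (xs : List ℕ) → ∑ xs (λ _ → 0) ≡ 0
    ∑0 xs = ∑-≡0 xs (λ _ → refl)

    mirror-inj : ∀ {i} → i ≤ k → ∀ i′ → i′ ≤ s → mirror k i′ ≡ mirror k i → i′ ≡ i
    mirror-inj i≤k i′ i′≤s = mirror-injective {k} (≤2k {k} (≤-trans i′≤s s≤k)) (≤2k {k} i≤k)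

    occurrences-row₁ : ∀ (g : ℕ → ℕ → V) → (∀ {a b c d} → g a b ≡ g c d → (a ≡ c) × (b ≡ d)) → ∀ b j → 1 ≤ j → j ≤ 2 * n →
      ∑ (fromTo 1 (2 * n)) (λ j′ → indicator (does (g 1 j′ ≟V g b j))) ≡ indicator (does (b ≟ 1))
    occurrences-row₁ g g-inj b j j≥1 j≤2n with b ≟ 1
    ... | yes refl = trans (occurrences-within (g 1) 1 (2 * n) j≥1 (λ j′ _ _ eq → proj₂ (g-inj eq)))
                       (trans (cong indicator (dec-true (j ≤? 2 * n) j≤2n)) (sym (cong indicator (dec-true (1 ≟ 1) refl))))
    ... | no b≢1 = trans (occurrences-none (g 1) 1 (2 * n) (λ j′ _ _ eq → b≢1 (sym (proj₁ (g-inj eq)))))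
                     (sym (cong indicator (dec-false (b ≟ 1) b≢1)))

  private
    occurrencesA : ∀ t → occurrences sideA t ≡ ∑ (fromTo 1 s) (λ i → indicator (does (u i ≟V t))) +
      (∑ (fromTo 1 s) (λ i → indicator (does (v (mirror k i) ≟V t))) + ∑ (fromTo 1 (2 * n)) (λ j → indicator (does (z 1 j ≟V t))))
    occurrencesA t = ∑-map³ (λ w → indicator (does (w ≟V t))) u (λ i → v (mirror k i)) (z 1) (fromTo 1 s) (fromTo 1 s) (fromTo 1 (2 * n))

    occurrencesB : ∀ t → occurrences sideB t ≡ ∑ (fromTo 1 s) (λ i → indicator (does (v i ≟V t))) +
      (∑ (fromTo 1 s) (λ i → indicator (does (u (mirror k i) ≟V t))) + ∑ (fromTo 1 (2 * n)) (λ j → indicator (does (y 1 j ≟V t))))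
    occurrencesB t = ∑-map³ (λ w → indicator (does (w ≟V t))) v (λ i → u (mirror k i)) (y 1) (fromTo 1 s) (fromTo 1 s) (fromTo 1 (2 * n))

  module _ {i} (i≥1 : 1 ≤ i) (i≤k : i ≤ k) where

    private
      i′≤k : ∀ {i′} → i′ ≤ s → i′ ≤ k
      i′≤k i′≤s = ≤-trans i′≤s s≤k

    occurrencesA-u : occurrences sideA (u i) ≡ indicator (does (i ≤? s))
    occurrencesA-u = trans (occurrencesA (u i)) (trans (cong₂ _+_ (occurrences-within u 1 s i≥1 (λ _ _ _ → u-inj))
      (cong₂ _+_ (∑0 (fromTo 1 s)) (∑0 (fromTo 1 (2 * n))))) (+-identityʳ _))

    occurrencesA-u-mirror : occurrences sideA (u (mirror k i)) ≡ 0
    occurrencesA-u-mirror = trans (occurrencesA (u (mirror k i))) (cong₂ _+_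
      (occurrences-none u 1 s (λ i′ _ i′≤s eq → ≢mirror {k} i≤k (i′≤k i′≤s) (u-inj eq)))
      (cong₂ _+_ (∑0 (fromTo 1 s)) (∑0 (fromTo 1 (2 * n)))))

    occurrencesA-v : occurrences sideA (v i) ≡ 0
    occurrencesA-v = trans (occurrencesA (v i)) (cong₂ _+_ (∑0 (fromTo 1 s))
      (cong₂ _+_ (occurrences-none (λ i′ → v (mirror k i′)) 1 s (λ i′ _ i′≤s eq → ≢mirror {k} (i′≤k i′≤s) i≤k (sym (v-inj eq))))
                 (∑0 (fromTo 1 (2 * n)))))

    occurrencesA-v-mirror : occurrences sideA (v (mirror k i)) ≡ indicator (does (i ≤? s))
    occurrencesA-v-mirror = trans (occurrencesA (v (mirror k i))) (cong₂ _+_ (∑0 (fromTo 1 s))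
      (trans (cong₂ _+_ (occurrences-within (λ i′ → v (mirror k i′)) 1 s i≥1 (λ i′ _ i′≤s eq → mirror-inj i≤k i′ i′≤s (v-inj eq)))
                        (∑0 (fromTo 1 (2 * n)))) (+-identityʳ _)))

    occurrencesB-v : occurrences sideB (v i) ≡ indicator (does (i ≤? s))
    occurrencesB-v = trans (occurrencesB (v i)) (trans (cong₂ _+_ (occurrences-within v 1 s i≥1 (λ _ _ _ → v-inj))
      (cong₂ _+_ (∑0 (fromTo 1 s)) (∑0 (fromTo 1 (2 * n))))) (+-identityʳ _))

    occurrencesB-v-mirror : occurrences sideB (v (mirror k i)) ≡ 0
    occurrencesB-v-mirror = trans (occurrencesB (v (mirror k i))) (cong₂ _+_
      (occurrences-none v 1 s (λ i′ _ i′≤s eq → ≢mirror {k} i≤k (i′≤k i′≤s) (v-inj eq)))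
      (cong₂ _+_ (∑0 (fromTo 1 s)) (∑0 (fromTo 1 (2 * n)))))

    occurrencesB-u : occurrences sideB (u i) ≡ 0
    occurrencesB-u = trans (occurrencesB (u i)) (cong₂ _+_ (∑0 (fromTo 1 s))
      (cong₂ _+_ (occurrences-none (λ i′ → u (mirror k i′)) 1 s (λ i′ _ i′≤s eq → ≢mirror {k} (i′≤k i′≤s) i≤k (sym (u-inj eq))))
                 (∑0 (fromTo 1 (2 * n)))))

    occurrencesB-u-mirror : occurrences sideB (u (mirror k i)) ≡ indicator (does (i ≤? s))
    occurrencesB-u-mirror = trans (occurrencesB (u (mirror k i))) (cong₂ _+_ (∑0 (fromTo 1 s))
      (trans (cong₂ _+_ (occurrences-within (λ i′ → u (mirror k i′)) 1 s i≥1 (λ i′ _ i′≤s eq → mirror-inj i≤k i′ i′≤s (u-inj eq)))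
                        (∑0 (fromTo 1 (2 * n)))) (+-identityʳ _)))

  module _ (b j : ℕ) (j≥1 : 1 ≤ j) (j≤2n : j ≤ 2 * n) where

    occurrencesA-y : occurrences sideA (y b j) ≡ 0
    occurrencesA-y = trans (occurrencesA (y b j)) (cong₂ _+_ (∑0 (fromTo 1 s)) (cong₂ _+_ (∑0 (fromTo 1 s)) (∑0 (fromTo 1 (2 * n)))))

    occurrencesA-z : occurrences sideA (z b j) ≡ indicator (does (b ≟ 1))
    occurrencesA-z = trans (occurrencesA (z b j)) (cong₂ _+_ (∑0 (fromTo 1 s)) (cong₂ _+_ (∑0 (fromTo 1 s)) (occurrences-row₁ z z-inj b j j≥1 j≤2n)))

    occurrencesB-y : occurrences sideB (y b j) ≡ indicator (does (b ≟ 1))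
    occurrencesB-y = trans (occurrencesB (y b j)) (cong₂ _+_ (∑0 (fromTo 1 s)) (cong₂ _+_ (∑0 (fromTo 1 s)) (occurrences-row₁ y y-inj b j j≥1 j≤2n)))

    occurrencesB-z : occurrences sideB (z b j) ≡ 0
    occurrencesB-z = trans (occurrencesB (z b j)) (cong₂ _+_ (∑0 (fromTo 1 s)) (cong₂ _+_ (∑0 (fromTo 1 s)) (∑0 (fromTo 1 (2 * n)))))

  private
    in-first-block : ∀ {b i} → 1 ≤ b → suc ((b ∸ 1) * s) ≤ i → i ≤ b * s → does (i ≤? s) ≡ does (b ≟ 1)
    in-first-block {suc zero} {i} _ _ i≤s = trans (dec-true (i ≤? s) (subst (i ≤_) (+-identityʳ s) i≤s)) (sym (dec-true (1 ≟ 1) refl))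
    in-first-block {suc (suc b)} {i} _ i≥ _ = trans (dec-false (i ≤? s) (λ i≤s → <-irrefl refl (<-≤-trans (s≤s (≤-trans i≤s (m≤m+n s (b * s)))) i≥)))
                                                    (sym (dec-false (suc (suc b) ≟ 1) (λ ())))

    matching-incidence : ∀ a b → incidence (u a) (u b , v b) 1 ≡ incidence (v a) (u b , v b) 1
    matching-incidence a b with a ≟ b
    ... | yes refl = refl
    ... | no _ = refl

  Balanced : V × V → Set
  Balanced e = endpointsIn sideA e ≡ endpointsIn sideB e

  balanced : All Balanced E
  balanced = All-edges Balanced matching quads
    where
    matching : ∀ i → 1 ≤ i → i ≤ 2 * k → Balanced (u i , v i)
    matching i _ _ = trans (∑-map³ (λ w → incidence w (u i , v i) 1) u (λ i′ → v (mirror k i′)) (z 1) (fromTo 1 s) (fromTo 1 s) (fromTo 1 (2 * n)))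
      (trans (cong₂ _+_ (∑-cong (fromTo 1 s) (λ i′ → matching-incidence i′ i))
                        (cong (_+ _) (∑-cong (fromTo 1 s) (λ i′ → sym (matching-incidence (mirror k i′) i)))))
        (sym (∑-map³ (λ w → incidence w (u i , v i) 1) v (λ i′ → u (mirror k i′)) (y 1) (fromTo 1 s) (fromTo 1 s) (fromTo 1 (2 * n)))))

    quads : ∀ b i j → 1 ≤ b → b ≤ r → suc ((b ∸ 1) * s) ≤ i → i ≤ b * s → 1 ≤ j → j ≤ 2 * n → All Balanced (quad b i j)
    quads b i j b≥1 b≤r i≥ i≤ j≥1 j≤2n =
      crossing (λ ()) (occurrencesA-u i≥1 i≤k) (occurrencesA-y b j j≥1 j≤2n) (occurrencesB-u i≥1 i≤k) (occurrencesB-y b j j≥1 j≤2n) ∷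
      crossing (λ ()) (occurrencesA-v-mirror i≥1 i≤k) (occurrencesA-y b j j≥1 j≤2n) (occurrencesB-v-mirror i≥1 i≤k) (occurrencesB-y b j j≥1 j≤2n) ∷
      crossing′ (λ ()) (occurrencesA-v i≥1 i≤k) (occurrencesA-z b j j≥1 j≤2n) (occurrencesB-v i≥1 i≤k) (occurrencesB-z b j j≥1 j≤2n) ∷
      crossing′ (λ ()) (occurrencesA-u-mirror i≥1 i≤k) (occurrencesA-z b j j≥1 j≤2n) (occurrencesB-u-mirror i≥1 i≤k) (occurrencesB-z b j j≥1 j≤2n) ∷ []
      where
      i≥1 : 1 ≤ i
      i≥1 = ≤-trans (s≤s z≤n) i≥
      i≤k : i ≤ k
      i≤k = ≤-trans i≤ (*-monoˡ-≤ s b≤r)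
      first : indicator (does (i ≤? s)) ≡ indicator (does (b ≟ 1))
      first = cong indicator (in-first-block b≥1 i≥ i≤)
      crossing : ∀ {a t} → a ≢ y b t → occurrences sideA a ≡ indicator (does (i ≤? s)) → occurrences sideA (y b t) ≡ 0 →
        occurrences sideB a ≡ 0 → occurrences sideB (y b t) ≡ indicator (does (b ≟ 1)) → Balanced (a , y b t)
      crossing {a} {t} a≢ A-a A-y B-a B-y = trans (endpointsIn-split sideA a (y b t) a≢)
        (trans (cong₂ _+_ A-a A-y) (trans (+-identityʳ _) (trans first
          (trans (sym (cong₂ _+_ B-a B-y)) (sym (endpointsIn-split sideB a (y b t) a≢))))))
      crossing′ : ∀ {a t} → a ≢ z b t → occurrences sideA a ≡ 0 → occurrences sideA (z b t) ≡ indicator (does (b ≟ 1)) →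
        occurrences sideB a ≡ indicator (does (i ≤? s)) → occurrences sideB (z b t) ≡ 0 → Balanced (a , z b t)
      crossing′ {a} {t} a≢ A-a A-z B-a B-z = trans (endpointsIn-split sideA a (z b t) a≢)
        (trans (cong₂ _+_ A-a A-z) (trans (sym first) (trans (sym (+-identityʳ _))
          (trans (sym (cong₂ _+_ B-a B-z)) (sym (endpointsIn-split sideB a (z b t) a≢))))))

  module _ (f : Labeling E) (antimagic : LocalAntimagic E f) where

    private
      fp : V → ℕ
      fp = fplus E f

      α β : ℕ
      α = fp (u 1)
      β = fp (v 1)

      adjacent≢ : ∀ {e} → e ∈ E → fp (proj₁ e) ≢ fp (proj₂ e)
      adjacent≢ e∈ eq = antimagic (Any.index e∈) (subst (λ e → fp (proj₁ e) ≡ fp (proj₂ e)) (lookup-index e∈) eq)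

      1≤2k : 1 ≤ 2 * k
      1≤2k = ≤2k {k} (≤-trans s≥1 s≤k)

      1≤2n : 1 ≤ 2 * n
      1≤2n = s≤s z≤n

      module _ {i j} (i≥1 : 1 ≤ i) (i≤s : i ≤ s) (j≥1 : 1 ≤ j) (j≤2n : j ≤ 2 * n) where
        quad₁-edges : ∀ {e} → e ∈ quad 1 i j → e ∈ E
        quad₁-edges = quad⊆edges 1 i j ≤-refl r≥1 i≥1 (subst (i ≤_) (sym (+-identityʳ s)) i≤s) j≥1 j≤2n

      N : ℕ
      N = s + (s + 2 * n)

    not-two-coloured : All (λ w → fp w ≡ α ⊎ fp w ≡ β) Vs → ⊥
    not-two-coloured two = adjacent≢ (matching∈edges 1 ≤-refl 1≤2k) α≡β
      where
      not-α : ∀ {w} → w ∈ Vs → fp w ≢ α → fp w ≡ β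
      not-α w∈ w≢α with All.lookup two w∈
      ... | inj₁ w≡α = ⊥-elim (w≢α w≡α)
      ... | inj₂ w≡β = w≡β

      not-β : ∀ {w} → w ∈ Vs → fp w ≢ β → fp w ≡ α
      not-β w∈ w≢β with All.lookup two w∈
      ... | inj₁ w≡α = w≡α
      ... | inj₂ w≡β = ⊥-elim (w≢β w≡β)

      y-β : ∀ j → 1 ≤ j → j ≤ 2 * n → fp (y 1 j) ≡ β
      y-β j j≥1 j≤2n = not-α (y∈Vs 1 j ≤-refl r≥1 j≥1 j≤2n)
        (λ eq → adjacent≢ (quad₁-edges ≤-refl s≥1 j≥1 j≤2n (here refl)) (sym eq))

      u-α : ∀ i → 1 ≤ i → i ≤ s → fp (u i) ≡ α
      u-α i i≥1 i≤s = not-β (u∈Vs i i≥1 (≤2k {k} (≤-trans i≤s s≤k)))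
        (λ eq → adjacent≢ (quad₁-edges i≥1 i≤s ≤-refl 1≤2n (here refl)) (trans eq (sym (y-β 1 ≤-refl 1≤2n))))

      v-mirror-α : ∀ i → 1 ≤ i → i ≤ s → fp (v (mirror k i)) ≡ α
      v-mirror-α i i≥1 i≤s = not-β (v∈Vs (mirror k i) (mirror≥1 (≤-trans i≤s s≤k)) (mirror≤2k {k} i≥1))
        (λ eq → adjacent≢ (quad₁-edges i≥1 i≤s ≤-refl 1≤2n (there (here refl))) (trans eq (sym (y-β 1 ≤-refl 1≤2n))))

      v-β : ∀ i → 1 ≤ i → i ≤ s → fp (v i) ≡ β
      v-β i i≥1 i≤s = not-α (v∈Vs i i≥1 i≤2k)
        (λ eq → adjacent≢ (matching∈edges i i≥1 i≤2k) (trans (u-α i i≥1 i≤s) (sym eq)))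
        where
        i≤2k : i ≤ 2 * k
        i≤2k = ≤2k {k} (≤-trans i≤s s≤k)

      z-α : ∀ j → 1 ≤ j → j ≤ 2 * n → fp (z 1 j) ≡ α
      z-α j j≥1 j≤2n = not-β (z∈Vs 1 j ≤-refl r≥1 j≥1 j≤2n)
        (λ eq → adjacent≢ (quad₁-edges ≤-refl s≥1 j≥1 j≤2n (there (there (here refl)))) (trans (v-β 1 ≤-refl s≥1) (sym eq)))

      u-mirror-β : ∀ i → 1 ≤ i → i ≤ s → fp (u (mirror k i)) ≡ β
      u-mirror-β i i≥1 i≤s = not-α (u∈Vs (mirror k i) (mirror≥1 (≤-trans i≤s s≤k)) (mirror≤2k {k} i≥1))
        (λ eq → adjacent≢ (quad₁-edges i≥1 i≤s ≤-refl 1≤2n (there (there (there (here refl))))) (trans eq (sym (z-α 1 ≤-refl 1≤2n))))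

      ∑-side : ∀ (g₁ g₂ g₃ : ℕ → V) c → (∀ i → 1 ≤ i → i ≤ s → fp (g₁ i) ≡ c) → (∀ i → 1 ≤ i → i ≤ s → fp (g₂ i) ≡ c) →
        (∀ j → 1 ≤ j → j ≤ 2 * n → fp (g₃ j) ≡ c) →
        ∑ (map g₁ (fromTo 1 s) ++ map g₂ (fromTo 1 s) ++ map g₃ (fromTo 1 (2 * n))) fp ≡ N * c
      ∑-side g₁ g₂ g₃ c c₁ c₂ c₃ = trans (∑-map³ fp g₁ g₂ g₃ (fromTo 1 s) (fromTo 1 s) (fromTo 1 (2 * n)))
        (trans (cong₂ _+_ (trans (fromTo-∑-cong 1 s c₁) (fromTo-∑-const s c))
                 (cong₂ _+_ (trans (fromTo-∑-cong 1 s c₂) (fromTo-∑-const s c)) (trans (fromTo-∑-cong 1 (2 * n) c₃) (fromTo-∑-const (2 * n) c))))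
          (sym (trans (*-distribʳ-+ c s (s + 2 * n)) (cong (s * c +_) (*-distribʳ-+ c s (2 * n))))))

      α≡β : α ≡ β
      α≡β = *-cancelˡ-≡ α β N {{>-nonZero (≤-trans s≥1 (m≤m+n s _))}}
        (trans (sym (∑-side u (λ i → v (mirror k i)) (z 1) α u-α v-mirror-α z-α))
          (trans (double-counting E f sideA sideB balanced) (∑-side v (λ i → u (mirror k i)) (y 1) β v-β u-mirror-β y-β)))

    numColors≥3 : 3 ≤ numColors E Vs f
    numColors≥3 with All.all? (λ w → (fp w ≟ α) ⊎-dec (fp w ≟ β)) Vs
    ... | yes two = ⊥-elim (not-two-coloured two)
    ... | no ¬two with find (¬All⇒Any¬ (λ w → (fp w ≟ α) ⊎-dec (fp w ≟ β)) Vs ¬two)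
    ...   | w , w∈ , w∉ = length-deduplicate≥3 (map fp Vs) (∈-map⁺ fp (u∈Vs 1 ≤-refl 1≤2k)) (∈-map⁺ fp (v∈Vs 1 ≤-refl 1≤2k))
              (∈-map⁺ fp w∈) (adjacent≢ (matching∈edges 1 ≤-refl 1≤2k)) (λ eq → w∉ (inj₁ (sym eq))) (λ eq → w∉ (inj₂ (sym eq)))

theorem2p5 : (n r s : ℕ) → 1 ≤ n → 2 ≤ r → 1 ≤ s →
    ChiLaEq (edges n r s) (vertices n r s) 3
theorem2p5 (suc n′) r s _ r≥2 s≥1 =
  (labeling , labeling-localAntimagic k≥1 , labeling-numColors k≥1 r≥1) , numColors≥3
  where
  r≥1 : 1 ≤ r
  r≥1 = ≤-trans (s≤s z≤n) r≥2

  k≥1 : 1 ≤ r * s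
  k≥1 = *-mono-≤ r≥1 s≥1

  open Construction n′ r s
  open Component n′ r s r≥1 s≥1 using (numColors≥3)
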